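{- (mp-cut for MRLJ) Let $n\geq1$ and $R_1,\ldots,R_n\subseteq\Omega$ with $\overline{R_1}\uplus\cdots\uplus\overline{R_n}=\Omega$. For every formula $A$ of MRLJ and all sequents $\Gamma_1,\ldots,\Gamma_n$ such that each sequent $\Gamma_i,R_i\{A\}$ is $\mathcal J$-intuitionistic, if $\vdash\Gamma_i,R_i\{A\}$ is derivable in MRLJ for each $1\le i\le n$, then $\vdash\Gamma_1,\ldots,\Gamma_n$ is derivable in MRLJ.
   Context: Fix a set $\Omega$ of roles (possibly infinite). A role set is a subset $R\subseteq\Omega$; $\overline{R}=\Omega\setminus R$; $R_1\uplus\cdots\uplus R_n=\Omega$ means the $R_i$ are pairwise disjoint with union $\Omega$. An ultrafilter on $\Omega$ is a family $\mathcal U$ of subsets of $\Omega$ with $\Omega\in\mathcal U$, closed upward and under binary intersection, and containing $R$ or $\overline R$ for every $R$. For an endomorphism $f$ of $\Omega$, $f^{ -1}(R)=\{r\mid f(r)\in R\}$. Formulas of MRLJ, over first-order terms $t$ and variables $x$: $A,B::=a\mid\neg_f(A)\mid A\wedge_{\mathcal U}B\mid A\supset_{f,\mathcal U}B\mid\forall_{\mathcal U}(\lambda x.A)$ ($a$ primitive, $f$ endomorphisms, $\mathcal U$ ultrafilters). An i-formula is $R\{A\}$; a sequent is a finite multiset of i-formulas. MRLJ is parameterized by a fixed ultrafilter $\mathcal J$ on $\Omega$; a sequent is $\mathcal J$-intuitionistic if it contains at most one i-formula $R\{A\}$ with $R\in\mathcal J$, and a rule instance is $\mathcal J$-intuitionistic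 if its conclusion and all premisses are. The rules of MRLJ are all $\mathcal J$-intuitionistic instances of the following rules: (Id) $\vdash R_1\{a\},\ldots,R_n\{a\}$ whenever $R_1\uplus\cdots\uplus R_n=\Omega$; (Weaken) from $\Gamma$ infer $\Gamma,R\{A\}$; (Contract) from $\Gamma,R\{A\},R\{A\}$ infer $\Gamma,R\{A\}$; ($\neg$) from $\Gamma,f^{ -1}(R)\{A\}$ infer $\Gamma,R\{\neg_f(A)\}$; ($\wedge$-neg-l/r) if $R\notin\mathcal U$, from $\Gamma,R\{A\}$ (resp. $\Gamma,R\{B\}$) infer $\Gamma,R\{A\wedge_{\mathcal U}B\}$; ($\wedge$-pos) if $R\in\mathcal U$, from $\Gamma,R\{A\}$ and $\Gamma,R\{B\}$ infer $\Gamma,R\{A\wedge_{\mathcal U}B\}$; ($\forall$-neg) if $R\notin\mathcal U$, from $\Gamma,R\{A[x:=t]\}$ infer $\Gamma,R\{\forall_{\mathcal U}(\lambda x.A)\}$; ($\forall$-pos) if $R\in\mathcal U$ and $x$ not free in $\Gamma$, from $\Gamma,R\{A\}$ infer $\Gamma,R\{\forall_{\mathcal U}(\lambda x.A)\}$; together with the implication rules ($\supset$-neg) if $R\notin\mathcal U$, from $\Gamma,f^{ -1}(R)\{A\},R\{B\}$ infer $\Gamma,R\{A\supset_{f,\mathcal U}B\}$; ($\supset$-pos) if $R\in\mathcal U$, from $\Gamma_1,f^{ -1}(R)\{A\}$ and $\Gamma_2,R\{B\}$ infer $\Gamma_1,\Gamma_2,R\{A\supset_{f,\mathcal U}B\}$.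 -}

module Defs where

open import Data.Bool using (Bool; true; false; not; _∧_)
open import Data.Nat using (ℕ; zero; suc)
open import Data.Fin using (Fin)
open import Data.List using (List; []; _∷_; map; tabulate)
open import Data.List.Relation.Unary.All using (All)
open import Data.List.Relation.Binary.Permutation.Homogeneous using (Permutation)
open import Data.Product using (Σ; _×_; _,_; proj₁; ∃-syntax)
open import Data.Sum using (_⊎_)
open import Relation.Binary.PropositionalEquality using (_≡_; _≢_)
open import Relation.Nullary using (¬_)

RoleSet : Set → Set
RoleSet Ω = Ω → Bool

module _ {Ω : Set} where

  ∁ : RoleSet Ω → RoleSet Ω
  ∁ R r = not (R r)

  full : RoleSet Ω
  full _ = true

  _∩_ : RoleSet Ω → RoleSet Ω → RoleSet Ω
  (R ∩ S) r = R r ∧ S r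

  _⊆_ : RoleSet Ω → RoleSet Ω → Set
  R ⊆ S = ∀ r → R r ≡ true → S r ≡ true

  preimage : (Ω → Ω) → RoleSet Ω → RoleSet Ω
  preimage f R r = R (f r)

  Partition : ∀ {n} → (Fin n → RoleSet Ω) → Set
  Partition {n} Rs =
    (∀ (i j : Fin n) → i ≢ j → ∀ r → ¬ (Rs i r ≡ true × Rs j r ≡ true))
    × (∀ r → ∃[ i ] (Rs i r ≡ true))

record Ultrafilter (Ω : Set) : Set₁ where
  field
    Mem    : RoleSet Ω → Set
    full∈  : Mem full
    upward : ∀ {R S} → R ⊆ S → Mem R → Mem S
    inter  : ∀ {R S} → Mem R → Mem S → Mem (R ∩ S)
    ultra  : ∀ R → Mem R ⊎ Mem (∁ R)

open Ultrafilter public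

data Term : Set where
  var : ℕ → Term
  fun : ℕ → List Term → Term

data Atom : Set where
  pred : ℕ → List Term → Atom

mutual
  renT : (ℕ → ℕ) → Term → Term
  renT ρ (var x)    = var (ρ x)
  renT ρ (fun g ts) = fun g (renTs ρ ts)

  renTs : (ℕ → ℕ) → List Term → List Term
  renTs ρ []       = []
  renTs ρ (t ∷ ts) = renT ρ t ∷ renTs ρ ts

mutual
  subT : (ℕ → Term) → Term → Term
  subT σ (var x)    = σ x
  subT σ (fun g ts) = fun g (subTs σ ts)

  subTs : (ℕ → Term) → List Term → List Term
  subTs σ []       = []
  subTs σ (t ∷ ts) = subT σ t ∷ subTs σ ts

ext : (ℕ → ℕ) → ℕ → ℕ
ext ρ zero    = zero
ext ρ (suc n) = suc (ρ n)

exts : (ℕ → Term) → ℕ → Term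
exts σ zero    = var zero
exts σ (suc n) = renT suc (σ n)

-- Formulas of MRLJ.  In  all U A  the body A binds de Bruijn index 0
-- (this is  ∀_U (λx.A) ).

data Formula (Ω : Set) : Set₁ where
  atom : Atom → Formula Ω
  neg  : (Ω → Ω) → Formula Ω → Formula Ω
  and  : Ultrafilter Ω → Formula Ω → Formula Ω → Formula Ω
  imp  : (Ω → Ω) → Ultrafilter Ω → Formula Ω → Formula Ω → Formula Ω
  all  : Ultrafilter Ω → Formula Ω → Formula Ω

module _ {Ω : Set} where

  renF : (ℕ → ℕ) → Formula Ω → Formula Ω
  renF ρ (atom (pred p ts)) = atom (pred p (renTs ρ ts))
  renF ρ (neg f A)     = neg f (renF ρ A)
  renF ρ (and U A B)   = and U (renF ρ A) (renF ρ B)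
  renF ρ (imp f U A B) = imp f U (renF ρ A) (renF ρ B)
  renF ρ (all U A)     = all U (renF (ext ρ) A)

  subF : (ℕ → Term) → Formula Ω → Formula Ω
  subF σ (atom (pred p ts)) = atom (pred p (subTs σ ts))
  subF σ (neg f A)     = neg f (subF σ A)
  subF σ (and U A B)   = and U (subF σ A) (subF σ B)
  subF σ (imp f U A B) = imp f U (subF σ A) (subF σ B)
  subF σ (all U A)     = all U (subF (exts σ) A)

  inst0 : Term → ℕ → Term
  inst0 t zero    = t
  inst0 t (suc n) = var n

  _[0:=_] : Formula Ω → Term → Formula Ω
  A [0:= t ] = subF (inst0 t) A

IFormula : Set → Set₁
IFormula Ω = RoleSet Ω × Formula Ω

Sequent : Set → Set₁
Sequent Ω = List (IFormula Ω)

data AtMostOne {A : Set₁} (P : A → Set) : List A → Set₁ where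
  []   : AtMostOne P []
  no∷  : ∀ {x xs} → ¬ P x → AtMostOne P xs → AtMostOne P (x ∷ xs)
  yes∷ : ∀ {x xs} → P x → All (λ y → ¬ P y) xs → AtMostOne P (x ∷ xs)

module _ {Ω : Set} where

  shift : Sequent Ω → Sequent Ω
  shift = map (λ ι → proj₁ ι , renF suc (Data.Product.proj₂ ι))

  _≈ᵢ_ : IFormula Ω → IFormula Ω → Set₁
  (R , A) ≈ᵢ (S , B) = (∀ r → R r ≡ S r) × A ≡ B

  _≈ₛ_ : Sequent Ω → Sequent Ω → Set₁
  Γ ≈ₛ Δ = Permutation _≈ᵢ_ Γ Δ

  Intu : Ultrafilter Ω → Sequent Ω → Set₁
  Intu J Γ = AtMostOne (λ ι → Mem J (proj₁ ι)) Γ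

-- Derivability in MRLJ (parameterised by the ultrafilter J).
-- Γ , R{A} is written  (R , A) ∷ Γ.

data MRLJ {Ω : Set} (J : Ultrafilter Ω) : Sequent Ω → Set₁ where
  -- sequents are multisets of i-formulas, role sets are sets
  mset : ∀ {Γ Δ} → Γ ≈ₛ Δ → MRLJ J Γ → MRLJ J Δ

  Id : ∀ {n} (Rs : Fin n → RoleSet Ω) (a : Atom) → Partition Rs →
       Intu J (tabulate (λ i → Rs i , atom a)) →
       MRLJ J (tabulate (λ i → Rs i , atom a))

  Weaken : ∀ {Γ R A} → Intu J Γ → Intu J ((R , A) ∷ Γ) →
           MRLJ J Γ → MRLJ J ((R , A) ∷ Γ)

  Contract : ∀ {Γ R A} → Intu J ((R , A) ∷ (R , A) ∷ Γ) → Intu J ((R , A) ∷ Γ) →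
             MRLJ J ((R , A) ∷ (R , A) ∷ Γ) → MRLJ J ((R , A) ∷ Γ)

  Neg : ∀ {Γ R f A} → Intu J ((preimage f R , A) ∷ Γ) → Intu J ((R , neg f A) ∷ Γ) →
        MRLJ J ((preimage f R , A) ∷ Γ) → MRLJ J ((R , neg f A) ∷ Γ)

  And-neg-l : ∀ {Γ R U A B} → ¬ Mem U R →
              Intu J ((R , A) ∷ Γ) → Intu J ((R , and U A B) ∷ Γ) →
              MRLJ J ((R , A) ∷ Γ) → MRLJ J ((R , and U A B) ∷ Γ)

  And-neg-r : ∀ {Γ R U A B} → ¬ Mem U R →
              Intu J ((R , B) ∷ Γ) → Intu J ((R , and U A B) ∷ Γ) →
              MRLJ J ((R , B) ∷ Γ) → MRLJ J ((R , and U A B) ∷ Γ)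

  And-pos : ∀ {Γ R U A B} → Mem U R →
            Intu J ((R , A) ∷ Γ) → Intu J ((R , B) ∷ Γ) → Intu J ((R , and U A B) ∷ Γ) →
            MRLJ J ((R , A) ∷ Γ) → MRLJ J ((R , B) ∷ Γ) → MRLJ J ((R , and U A B) ∷ Γ)

  All-neg : ∀ {Γ R U A} (t : Term) → ¬ Mem U R →
            Intu J ((R , A [0:= t ]) ∷ Γ) → Intu J ((R , all U A) ∷ Γ) →
            MRLJ J ((R , A [0:= t ]) ∷ Γ) → MRLJ J ((R , all U A) ∷ Γ)

  -- eigenvariable condition: the bound variable is fresh for Γ (de Bruijn shift)
  All-pos : ∀ {Γ R U A} → Mem U R →
            Intu J ((R , A) ∷ shift Γ) → Intu J ((R , all U A) ∷ Γ) →
            MRLJ J ((R , A) ∷ shift Γ) → MRLJ J ((R , all U A) ∷ Γ)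

  Imp-neg : ∀ {Γ R f U A B} → ¬ Mem U R →
            Intu J ((preimage f R , A) ∷ (R , B) ∷ Γ) → Intu J ((R , imp f U A B) ∷ Γ) →
            MRLJ J ((preimage f R , A) ∷ (R , B) ∷ Γ) → MRLJ J ((R , imp f U A B) ∷ Γ)

  Imp-pos : ∀ {Γ₁ Γ₂ R f U A B} → Mem U R →
            Intu J ((preimage f R , A) ∷ Γ₁) → Intu J ((R , B) ∷ Γ₂) →
            Intu J ((R , imp f U A B) ∷ Data.List._++_ Γ₁ Γ₂) →
            MRLJ J ((preimage f R , A) ∷ Γ₁) → MRLJ J ((R , B) ∷ Γ₂) →
            MRLJ J ((R , imp f U A B) ∷ Data.List._++_ Γ₁ Γ₂)

-- The argument is a multicut elimination in the style of Gentzen's mix. Each premise may cut a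
-- nonempty selection of occurrences of Rᵢ{A}, and the claim is proved by lexicographic induction on
-- the size of A and the total height of the premises. If some premise does not end with a rule
-- introducing a selected occurrence, the multicut is pushed above that rule. Otherwise all premises
-- introduce A. As the complements of the Rᵢ are pairwise disjoint, an ultrafilter misses at most one
-- Rᵢ, so at most one premise ends with a negative rule, and the multicut reduces to multicuts on
-- immediate subformulas of A; for an atom the premises are instances of Id whose remainders again
-- form one. Selected occurrences left in the subderivations are cut first, at smaller height; this
-- duplicates the other premises' contexts only when Rᵢ ∉ J, in which case every other Rⱼ is in J,
-- those contexts are J-free, and the duplicates can be contracted.

module Submission where

open import Defs
open import Level using (0ℓ) renaming (suc to lsuc)
open import Data.Bool using (Bool; true; false; _∧_)
open import Data.Nat using (ℕ; zero; suc; _+_; _⊔_; _≤_; _<_; z≤n; s≤s)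
open import Data.Nat.Properties
  using (≤-refl; ≤-reflexive; ≤-trans; ≤-pred; +-mono-≤; +-mono-<-≤; +-mono-≤-<; +-comm; +-assoc;
         m≤m+n; m≤n+m; m≤m⊔n; m≤n⊔m; +-0-monoid; +-commutativeSemigroup)
open import Data.Fin using (Fin; zero; suc; _≟_)
open import Data.Fin.Properties using (suc-injective)
open import Data.List using ([]; _∷_; _++_; map; concat; tabulate; lookup)
import Data.List.Properties as List
open import Data.List.Relation.Unary.All using (All; []; _∷_)
import Data.List.Relation.Unary.All.Properties as All
open import Data.List.Relation.Binary.Pointwise using (Pointwise; []; _∷_)
open import Data.List.Relation.Binary.Permutation.Homogeneous using (refl; prep; swap; trans)
open import Data.Product using (Σ-syntax; _×_; _,_; proj₁; proj₂; ∃-syntax)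
open import Data.Sum using (_⊎_; inj₁; inj₂; [_,_]′) renaming (swap to ⊎-swap)
open import Data.Empty using (⊥; ⊥-elim)
open import Function using (_∘_; id)
open import Relation.Nullary using (¬_; yes; no)
open import Relation.Binary.Bundles using (Setoid)
open import Relation.Binary.PropositionalEquality as ≡ using (_≡_; _≢_; cong; cong₂)
open import Algebra.Properties.Monoid.Sum +-0-monoid using (sum; sum-cong-≗)
open import Algebra.Properties.CommutativeSemigroup +-commutativeSemigroup using (x∙yz≈y∙xz)

-- Permutations and J-intuitionistic sequents

module _ {Ω : Set} where

  _≈ᴿ_ : RoleSet Ω → RoleSet Ω → Set
  R ≈ᴿ S = ∀ r → R r ≡ S r

  ≈ᵢ-refl : {x : IFormula Ω} → x ≈ᵢ x
  ≈ᵢ-refl = (λ _ → ≡.refl) , ≡.refl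

  ≈ᵢ-sym : {x y : IFormula Ω} → x ≈ᵢ y → y ≈ᵢ x
  ≈ᵢ-sym (e , q) = (λ r → ≡.sym (e r)) , ≡.sym q

  ≈ᵢ-trans : {x y z : IFormula Ω} → x ≈ᵢ y → y ≈ᵢ z → x ≈ᵢ z
  ≈ᵢ-trans (e , q) (e' , q') = (λ r → ≡.trans (e r) (e' r)) , ≡.trans q q'

  ≈ᵢ-setoid : Setoid (lsuc 0ℓ) (lsuc 0ℓ)
  ≈ᵢ-setoid = record
    { Carrier = IFormula Ω ; _≈_ = _≈ᵢ_
    ; isEquivalence = record { refl = ≈ᵢ-refl ; sym = ≈ᵢ-sym ; trans = ≈ᵢ-trans } }

module _ {Ω : Set} where
  open import Data.List.Relation.Binary.Permutation.Setoid (≈ᵢ-setoid {Ω}) public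
    hiding (refl; prep; swap; trans)
  open import Data.List.Relation.Binary.Permutation.Setoid.Properties (≈ᵢ-setoid {Ω}) public
    hiding (shift)

module _ {Ω : Set} (J : Ultrafilter Ω) where

  InJ : IFormula Ω → Set
  InJ x = Mem J (proj₁ x)

  JFree : Sequent Ω → Set₁
  JFree = All (λ x → ¬ InJ x)

  Mem-resp : ∀ {R S} → R ≈ᴿ S → Mem J R → Mem J S
  Mem-resp e = upward J (λ r p → ≡.trans (≡.sym (e r)) p)

  InJ-resp : ∀ {x y} → x ≈ᵢ y → InJ x → InJ y
  InJ-resp (e , _) = Mem-resp e

  JFree⇒Intu : ∀ {X} → JFree X → Intu J X
  JFree⇒Intu [] = []
  JFree⇒Intu (p ∷ f) = no∷ p (JFree⇒Intu f)

  Intu-tail : ∀ {x X} → Intu J (x ∷ X) → Intu J X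
  Intu-tail (no∷ _ i) = i
  Intu-tail (yes∷ _ f) = JFree⇒Intu f

  Intu-head : ∀ {x X} → Intu J (x ∷ X) → InJ x → JFree X
  Intu-head (no∷ np _) p = ⊥-elim (np p)
  Intu-head (yes∷ _ f) p = f

  Intu-++-JFree : ∀ {X Y} → Intu J X → JFree Y → Intu J (X ++ Y)
  Intu-++-JFree [] fy = JFree⇒Intu fy
  Intu-++-JFree (no∷ p i) fy = no∷ p (Intu-++-JFree i fy)
  Intu-++-JFree (yes∷ p f) fy = yes∷ p (All.++⁺ f fy)

  JFree-++-Intu : ∀ {X Y} → JFree X → Intu J Y → Intu J (X ++ Y)
  JFree-++-Intu [] iy = iy
  JFree-++-Intu (p ∷ f) iy = no∷ p (JFree-++-Intu f iy)

  JFree-resp-↭ : ∀ {X Y} → X ↭ Y → JFree X → JFree Y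
  JFree-resp-↭ = All-resp-↭ (λ e np q → np (InJ-resp (≈ᵢ-sym e) q))

  Intu-resp-Pointwise : ∀ {X Y} → Pointwise _≈ᵢ_ X Y → Intu J X → Intu J Y
  Intu-resp-Pointwise [] [] = []
  Intu-resp-Pointwise (e ∷ es) (no∷ np i) =
    no∷ (λ q → np (InJ-resp (≈ᵢ-sym e) q)) (Intu-resp-Pointwise es i)
  Intu-resp-Pointwise (e ∷ es) (yes∷ p f) = yes∷ (InJ-resp e p) (JFree-resp-↭ (refl es) f)

  Intu-resp-↭ : ∀ {X Y} → X ↭ Y → Intu J X → Intu J Y
  Intu-resp-↭ (refl pw) i = Intu-resp-Pointwise pw i
  Intu-resp-↭ (prep e p) (no∷ np i) = no∷ (λ q → np (InJ-resp (≈ᵢ-sym e) q)) (Intu-resp-↭ p i)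
  Intu-resp-↭ (prep e p) (yes∷ q f) = yes∷ (InJ-resp e q) (JFree-resp-↭ p f)
  Intu-resp-↭ (swap e₁ e₂ p) (no∷ nx (no∷ ny i)) =
    no∷ (λ q → ny (InJ-resp (≈ᵢ-sym e₂) q)) (no∷ (λ q → nx (InJ-resp (≈ᵢ-sym e₁) q)) (Intu-resp-↭ p i))
  Intu-resp-↭ (swap e₁ e₂ p) (no∷ nx (yes∷ qy f)) =
    yes∷ (InJ-resp e₂ qy) ((λ q → nx (InJ-resp (≈ᵢ-sym e₁) q)) ∷ JFree-resp-↭ p f)
  Intu-resp-↭ (swap e₁ e₂ p) (yes∷ qx (ny ∷ f)) =
    no∷ (λ q → ny (InJ-resp (≈ᵢ-sym e₂) q)) (yes∷ (InJ-resp e₁ qx) (JFree-resp-↭ p f))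
  Intu-resp-↭ (trans p q) i = Intu-resp-↭ q (Intu-resp-↭ p i)

  MRLJ⇒Intu : ∀ {Γ} → MRLJ J Γ → Intu J Γ
  MRLJ⇒Intu (mset p d) = Intu-resp-↭ p (MRLJ⇒Intu d)
  MRLJ⇒Intu (Id _ _ _ i) = i
  MRLJ⇒Intu (Weaken _ i _) = i
  MRLJ⇒Intu (Contract _ i _) = i
  MRLJ⇒Intu (Neg _ i _) = i
  MRLJ⇒Intu (And-neg-l _ _ i _) = i
  MRLJ⇒Intu (And-neg-r _ _ i _) = i
  MRLJ⇒Intu (And-pos _ _ _ i _ _) = i
  MRLJ⇒Intu (All-neg _ _ _ i _) = i
  MRLJ⇒Intu (All-pos _ _ i _) = i
  MRLJ⇒Intu (Imp-neg _ _ i _) = i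
  MRLJ⇒Intu (Imp-pos _ _ _ i _ _) = i

  weaken-++ˡ : ∀ Δ {Γ} → MRLJ J Γ → Intu J (Δ ++ Γ) → MRLJ J (Δ ++ Γ)
  weaken-++ˡ [] d _ = d
  weaken-++ˡ (x ∷ Δ) d i = Weaken (Intu-tail i) i (weaken-++ˡ Δ d (Intu-tail i))

  weaken-++ʳ : ∀ {Γ} Δ → MRLJ J Γ → Intu J (Γ ++ Δ) → MRLJ J (Γ ++ Δ)
  weaken-++ʳ {Γ} Δ d i = mset (++-comm Δ Γ) (weaken-++ˡ Δ d (Intu-resp-↭ (++-comm Γ Δ) i))

  -- The premise of each Contract holds two copies of an i-formula of Y; it is
  -- J-intuitionistic only because Y is J-free.
  contract-++ : ∀ Y {X} → MRLJ J (Y ++ Y ++ X) → JFree Y → Intu J (Y ++ X) → MRLJ J (Y ++ X)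
  contract-++ [] d _ _ = d
  contract-++ (y ∷ Y) {X} d (_ ∷ fY) i =
    mset (↭-shift Y X) (contract-++ Y {y ∷ X} d′ fY (Intu-resp-↭ (↭-sym (↭-shift Y X)) i))
    where
      twice : MRLJ J (y ∷ y ∷ Y ++ Y ++ X)
      twice = mset (↭-prep y (↭-shift Y (Y ++ X))) d
      once : MRLJ J (y ∷ Y ++ Y ++ X)
      once = Contract (MRLJ⇒Intu twice) (Intu-resp-↭ (↭-shift Y (Y ++ X)) (JFree-++-Intu fY i)) twice
      d′ : MRLJ J (Y ++ Y ++ y ∷ X)
      d′ = mset (trans (↭-sym (↭-shift Y (Y ++ X))) (++⁺ˡ Y (↭-sym (↭-shift Y X)))) once

-- Substitution

Sub : Set
Sub = ℕ → Term

mutual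
  subT-ext : ∀ {σ τ : Sub} → (∀ x → σ x ≡ τ x) → ∀ t → subT σ t ≡ subT τ t
  subT-ext e (var x) = e x
  subT-ext e (fun g ts) = cong (fun g) (subTs-ext e ts)

  subTs-ext : ∀ {σ τ : Sub} → (∀ x → σ x ≡ τ x) → ∀ ts → subTs σ ts ≡ subTs τ ts
  subTs-ext e [] = ≡.refl
  subTs-ext e (t ∷ ts) = cong₂ _∷_ (subT-ext e t) (subTs-ext e ts)

mutual
  subT-id : ∀ t → subT var t ≡ t
  subT-id (var x) = ≡.refl
  subT-id (fun g ts) = cong (fun g) (subTs-id ts)

  subTs-id : ∀ ts → subTs var ts ≡ ts
  subTs-id [] = ≡.refl
  subTs-id (t ∷ ts) = cong₂ _∷_ (subT-id t) (subTs-id ts)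

mutual
  subT-sub : ∀ (σ τ : Sub) t → subT σ (subT τ t) ≡ subT (subT σ ∘ τ) t
  subT-sub σ τ (var x) = ≡.refl
  subT-sub σ τ (fun g ts) = cong (fun g) (subTs-sub σ τ ts)

  subTs-sub : ∀ (σ τ : Sub) ts → subTs σ (subTs τ ts) ≡ subTs (subT σ ∘ τ) ts
  subTs-sub σ τ [] = ≡.refl
  subTs-sub σ τ (t ∷ ts) = cong₂ _∷_ (subT-sub σ τ t) (subTs-sub σ τ ts)

mutual
  renT≡subT : ∀ (ρ : ℕ → ℕ) t → renT ρ t ≡ subT (var ∘ ρ) t
  renT≡subT ρ (var x) = ≡.refl
  renT≡subT ρ (fun g ts) = cong (fun g) (renTs≡subTs ρ ts)

  renTs≡subTs : ∀ (ρ : ℕ → ℕ) ts → renTs ρ ts ≡ subTs (var ∘ ρ) ts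
  renTs≡subTs ρ [] = ≡.refl
  renTs≡subTs ρ (t ∷ ts) = cong₂ _∷_ (renT≡subT ρ t) (renTs≡subTs ρ ts)

mutual
  subT-exts-renT : ∀ (σ : Sub) t → subT (exts σ) (renT suc t) ≡ renT suc (subT σ t)
  subT-exts-renT σ (var x) = ≡.refl
  subT-exts-renT σ (fun g ts) = cong (fun g) (subTs-exts-renTs σ ts)

  subTs-exts-renTs : ∀ (σ : Sub) ts → subTs (exts σ) (renTs suc ts) ≡ renTs suc (subTs σ ts)
  subTs-exts-renTs σ [] = ≡.refl
  subTs-exts-renTs σ (t ∷ ts) = cong₂ _∷_ (subT-exts-renT σ t) (subTs-exts-renTs σ ts)

mutual
  subT-renT : ∀ (σ : Sub) (ρ : ℕ → ℕ) t → subT σ (renT ρ t) ≡ subT (σ ∘ ρ) t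
  subT-renT σ ρ (var x) = ≡.refl
  subT-renT σ ρ (fun g ts) = cong (fun g) (subTs-renTs σ ρ ts)

  subTs-renTs : ∀ (σ : Sub) (ρ : ℕ → ℕ) ts → subTs σ (renTs ρ ts) ≡ subTs (σ ∘ ρ) ts
  subTs-renTs σ ρ [] = ≡.refl
  subTs-renTs σ ρ (t ∷ ts) = cong₂ _∷_ (subT-renT σ ρ t) (subTs-renTs σ ρ ts)

exts-ext : ∀ {σ τ : Sub} → (∀ x → σ x ≡ τ x) → ∀ x → exts σ x ≡ exts τ x
exts-ext e zero = ≡.refl
exts-ext e (suc x) = cong (renT suc) (e x)

module _ {Ω : Set} where

  size : Formula Ω → ℕ
  size (atom _) = 0
  size (neg f A) = suc (size A)
  size (and U A B) = suc (size A ⊔ size B)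
  size (imp f U A B) = suc (size A ⊔ size B)
  size (all U A) = suc (size A)

  size-subF : ∀ (σ : Sub) A → size (subF σ A) ≡ size A
  size-subF σ (atom (pred p ts)) = ≡.refl
  size-subF σ (neg f A) = cong suc (size-subF σ A)
  size-subF σ (and U A B) = cong suc (cong₂ _⊔_ (size-subF σ A) (size-subF σ B))
  size-subF σ (imp f U A B) = cong suc (cong₂ _⊔_ (size-subF σ A) (size-subF σ B))
  size-subF σ (all U A) = cong suc (size-subF (exts σ) A)

  subF-ext : ∀ {σ τ : Sub} → (∀ x → σ x ≡ τ x) → (A : Formula Ω) → subF σ A ≡ subF τ A
  subF-ext e (atom (pred p ts)) = cong (atom ∘ pred p) (subTs-ext e ts)
  subF-ext e (neg f A) = cong (neg f) (subF-ext e A)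
  subF-ext e (and U A B) = cong₂ (and U) (subF-ext e A) (subF-ext e B)
  subF-ext e (imp f U A B) = cong₂ (imp f U) (subF-ext e A) (subF-ext e B)
  subF-ext e (all U A) = cong (all U) (subF-ext (exts-ext e) A)

  subF-id : (A : Formula Ω) → subF var A ≡ A
  subF-id (atom (pred p ts)) = cong (atom ∘ pred p) (subTs-id ts)
  subF-id (neg f A) = cong (neg f) (subF-id A)
  subF-id (and U A B) = cong₂ (and U) (subF-id A) (subF-id B)
  subF-id (imp f U A B) = cong₂ (imp f U) (subF-id A) (subF-id B)
  subF-id (all U A) = cong (all U) (≡.trans (subF-ext exts-var A) (subF-id A))
    where exts-var : ∀ x → exts var x ≡ var x
          exts-var zero = ≡.refl
          exts-var (suc x) = ≡.refl

  subF-sub : ∀ (σ τ : Sub) (A : Formula Ω) → subF σ (subF τ A) ≡ subF (subT σ ∘ τ) A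
  subF-sub σ τ (atom (pred p ts)) = cong (atom ∘ pred p) (subTs-sub σ τ ts)
  subF-sub σ τ (neg f A) = cong (neg f) (subF-sub σ τ A)
  subF-sub σ τ (and U A B) = cong₂ (and U) (subF-sub σ τ A) (subF-sub σ τ B)
  subF-sub σ τ (imp f U A B) = cong₂ (imp f U) (subF-sub σ τ A) (subF-sub σ τ B)
  subF-sub σ τ (all U A) = cong (all U) (≡.trans (subF-sub (exts σ) (exts τ) A) (subF-ext exts-sub A))
    where exts-sub : ∀ x → subT (exts σ) (exts τ x) ≡ exts (subT σ ∘ τ) x
          exts-sub zero = ≡.refl
          exts-sub (suc x) = subT-exts-renT σ (τ x)

  renF≡subF : ∀ (ρ : ℕ → ℕ) (A : Formula Ω) → renF ρ A ≡ subF (var ∘ ρ) A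
  renF≡subF ρ (atom (pred p ts)) = cong (atom ∘ pred p) (renTs≡subTs ρ ts)
  renF≡subF ρ (neg f A) = cong (neg f) (renF≡subF ρ A)
  renF≡subF ρ (and U A B) = cong₂ (and U) (renF≡subF ρ A) (renF≡subF ρ B)
  renF≡subF ρ (imp f U A B) = cong₂ (imp f U) (renF≡subF ρ A) (renF≡subF ρ B)
  renF≡subF ρ (all U A) = cong (all U) (≡.trans (renF≡subF (ext ρ) A) (subF-ext ext-var A))
    where ext-var : ∀ x → var (ext ρ x) ≡ exts (var ∘ ρ) x
          ext-var zero = ≡.refl
          ext-var (suc x) = ≡.refl

  size-renF : ∀ ρ (A : Formula Ω) → size (renF ρ A) ≡ size A
  size-renF ρ A = ≡.trans (cong size (renF≡subF ρ A)) (size-subF (var ∘ ρ) A)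

  open ≡.≡-Reasoning

  subF-inst : ∀ (σ : Sub) (A : Formula Ω) t → subF σ (A [0:= t ]) ≡ subF (exts σ) A [0:= subT σ t ]
  subF-inst σ A t = begin
    subF σ (subF (inst0 {Ω} t) A)                 ≡⟨ subF-sub σ (inst0 {Ω} t) A ⟩
    subF (subT σ ∘ inst0 {Ω} t) A                 ≡⟨ subF-ext agree A ⟩
    subF (subT (inst0 {Ω} (subT σ t)) ∘ exts σ) A ≡⟨ subF-sub (inst0 {Ω} (subT σ t)) (exts σ) A ⟨
    subF (inst0 {Ω} (subT σ t)) (subF (exts σ) A) ∎
    where agree : ∀ x → subT σ (inst0 {Ω} t x) ≡ subT (inst0 {Ω} (subT σ t)) (exts σ x)
          agree zero = ≡.refl
          agree (suc x) = ≡.sym (≡.trans (subT-renT (inst0 {Ω} (subT σ t)) suc (σ x)) (subT-id (σ x)))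

  subF-exts-renF : ∀ (σ : Sub) (B : Formula Ω) → subF (exts σ) (renF suc B) ≡ renF suc (subF σ B)
  subF-exts-renF σ B = begin
    subF (exts σ) (renF suc B)         ≡⟨ cong (subF (exts σ)) (renF≡subF suc B) ⟩
    subF (exts σ) (subF (var ∘ suc) B) ≡⟨ subF-sub (exts σ) (var ∘ suc) B ⟩
    subF (exts σ ∘ suc) B              ≡⟨ subF-ext (renT≡subT suc ∘ σ) B ⟩
    subF (subT (var ∘ suc) ∘ σ) B      ≡⟨ subF-sub (var ∘ suc) σ B ⟨
    subF (var ∘ suc) (subF σ B)        ≡⟨ renF≡subF suc (subF σ B) ⟨
    renF suc (subF σ B)                ∎

  inst-renF-suc : ∀ (B : Formula Ω) t → renF suc B [0:= t ] ≡ B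
  inst-renF-suc B t = begin
    subF (inst0 {Ω} t) (renF suc B)         ≡⟨ cong (subF (inst0 {Ω} t)) (renF≡subF suc B) ⟩
    subF (inst0 {Ω} t) (subF (var ∘ suc) B) ≡⟨ subF-sub (inst0 {Ω} t) (var ∘ suc) B ⟩
    subF var B                              ≡⟨ subF-id B ⟩
    B                                       ∎

module _ {Ω : Set} where

  subIF : Sub → IFormula Ω → IFormula Ω
  subIF σ (R , A) = R , subF σ A

  subSeq : Sub → Sequent Ω → Sequent Ω
  subSeq σ = map (subIF σ)

  ≈ᵢ-sub : ∀ σ {x y} → x ≈ᵢ y → subIF σ x ≈ᵢ subIF σ y
  ≈ᵢ-sub σ (e , q) = e , cong (subF σ) q

  Pointwise-sub : ∀ σ {Γ Δ} → Pointwise _≈ᵢ_ Γ Δ → Pointwise _≈ᵢ_ (subSeq σ Γ) (subSeq σ Δ)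
  Pointwise-sub σ [] = []
  Pointwise-sub σ (e ∷ p) = ≈ᵢ-sub σ e ∷ Pointwise-sub σ p

  ↭-sub : ∀ σ {Γ Δ} → Γ ↭ Δ → subSeq σ Γ ↭ subSeq σ Δ
  ↭-sub σ (refl p) = refl (Pointwise-sub σ p)
  ↭-sub σ (prep e p) = prep (≈ᵢ-sub σ e) (↭-sub σ p)
  ↭-sub σ (swap e₁ e₂ p) = swap (≈ᵢ-sub σ e₁) (≈ᵢ-sub σ e₂) (↭-sub σ p)
  ↭-sub σ (trans p q) = trans (↭-sub σ p) (↭-sub σ q)

  subSeq-shift : ∀ σ Γ → subSeq (exts σ) (shift Γ) ≡ shift (subSeq σ Γ)
  subSeq-shift σ [] = ≡.refl
  subSeq-shift σ ((R , B) ∷ Γ) = cong₂ _∷_ (cong (R ,_) (subF-exts-renF σ B)) (subSeq-shift σ Γ)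

  shift≡subSeq : ∀ Γ → shift Γ ≡ subSeq (var ∘ suc) Γ
  shift≡subSeq [] = ≡.refl
  shift≡subSeq ((R , B) ∷ Γ) = cong₂ _∷_ (cong (R ,_) (renF≡subF suc B)) (shift≡subSeq Γ)

  subSeq-inst-shift : ∀ t Γ → subSeq (inst0 {Ω} t) (shift Γ) ≡ Γ
  subSeq-inst-shift t [] = ≡.refl
  subSeq-inst-shift t ((R , B) ∷ Γ) = cong₂ _∷_ (cong (R ,_) (inst-renF-suc B t)) (subSeq-inst-shift t Γ)

module _ {Ω : Set} (J : Ultrafilter Ω) where

  height : ∀ {Γ} → MRLJ J Γ → ℕ
  height (mset _ d) = suc (height d)
  height (Id _ _ _ _) = 1
  height (Weaken _ _ d) = suc (height d)
  height (Contract _ _ d) = suc (height d)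
  height (Neg _ _ d) = suc (height d)
  height (And-neg-l _ _ _ d) = suc (height d)
  height (And-neg-r _ _ _ d) = suc (height d)
  height (And-pos _ _ _ _ d e) = suc (height d ⊔ height e)
  height (All-neg _ _ _ _ d) = suc (height d)
  height (All-pos _ _ _ d) = suc (height d)
  height (Imp-neg _ _ _ d) = suc (height d)
  height (Imp-pos _ _ _ _ d e) = suc (height d ⊔ height e)

  1≤height : ∀ {Γ} (d : MRLJ J Γ) → 1 ≤ height d
  1≤height (mset _ _) = s≤s z≤n
  1≤height (Id _ _ _ _) = s≤s z≤n
  1≤height (Weaken _ _ _) = s≤s z≤n
  1≤height (Contract _ _ _) = s≤s z≤n
  1≤height (Neg _ _ _) = s≤s z≤n
  1≤height (And-neg-l _ _ _ _) = s≤s z≤n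
  1≤height (And-neg-r _ _ _ _) = s≤s z≤n
  1≤height (And-pos _ _ _ _ _ _) = s≤s z≤n
  1≤height (All-neg _ _ _ _ _) = s≤s z≤n
  1≤height (All-pos _ _ _ _) = s≤s z≤n
  1≤height (Imp-neg _ _ _ _) = s≤s z≤n
  1≤height (Imp-pos _ _ _ _ _ _) = s≤s z≤n

  cast : ∀ {Γ Δ} → Γ ≡ Δ → MRLJ J Γ → MRLJ J Δ
  cast ≡.refl d = d

  OfHeight : Sequent Ω → ℕ → Set₁
  OfHeight Γ h = Σ[ d ∈ MRLJ J Γ ] height d ≡ h

  recast : ∀ {Γ Δ h} → Γ ≡ Δ → OfHeight Γ h → OfHeight Δ h
  recast ≡.refl d = d

  JFree-sub : ∀ σ {Γ} → JFree J Γ → JFree J (subSeq σ Γ)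
  JFree-sub σ [] = []
  JFree-sub σ (q ∷ f) = q ∷ JFree-sub σ f

  Intu-sub : ∀ σ {Γ} → Intu J Γ → Intu J (subSeq σ Γ)
  Intu-sub σ [] = []
  Intu-sub σ (no∷ n i) = no∷ n (Intu-sub σ i)
  Intu-sub σ (yes∷ p f) = yes∷ p (JFree-sub σ f)

  sub-MRLJ : ∀ σ {Γ} (d : MRLJ J Γ) → OfHeight (subSeq σ Γ) (height d)
  sub-MRLJ σ (mset p d) = let d′ , e = sub-MRLJ σ d in mset (↭-sub σ p) d′ , cong suc e
  sub-MRLJ σ (Id Rs (pred p ts) pt i) =
    recast (≡.sym (List.map-tabulate _ (subIF σ)))
      (Id Rs (pred p (subTs σ ts)) pt (≡.subst (Intu J) (List.map-tabulate _ (subIF σ)) (Intu-sub σ i)) , ≡.refl)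
  sub-MRLJ σ (Weaken i₁ i₂ d) =
    let d′ , e = sub-MRLJ σ d in Weaken (Intu-sub σ i₁) (Intu-sub σ i₂) d′ , cong suc e
  sub-MRLJ σ (Contract i₁ i₂ d) =
    let d′ , e = sub-MRLJ σ d in Contract (Intu-sub σ i₁) (Intu-sub σ i₂) d′ , cong suc e
  sub-MRLJ σ (Neg i₁ i₂ d) =
    let d′ , e = sub-MRLJ σ d in Neg (Intu-sub σ i₁) (Intu-sub σ i₂) d′ , cong suc e
  sub-MRLJ σ (And-neg-l m i₁ i₂ d) =
    let d′ , e = sub-MRLJ σ d in And-neg-l m (Intu-sub σ i₁) (Intu-sub σ i₂) d′ , cong suc e
  sub-MRLJ σ (And-neg-r m i₁ i₂ d) =
    let d′ , e = sub-MRLJ σ d in And-neg-r m (Intu-sub σ i₁) (Intu-sub σ i₂) d′ , cong suc e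
  sub-MRLJ σ (And-pos m i₁ i₂ i₃ d₁ d₂) =
    let d₁′ , e₁ = sub-MRLJ σ d₁ ; d₂′ , e₂ = sub-MRLJ σ d₂
    in And-pos m (Intu-sub σ i₁) (Intu-sub σ i₂) (Intu-sub σ i₃) d₁′ d₂′ , cong suc (cong₂ _⊔_ e₁ e₂)
  sub-MRLJ σ (All-neg {Γ} {R} {A = A} t m i₁ i₂ d) =
    let d′ , e = recast eq (sub-MRLJ σ d)
    in All-neg (subT σ t) m (≡.subst (Intu J) eq (Intu-sub σ i₁)) (Intu-sub σ i₂) d′ , cong suc e
    where eq : subSeq σ ((R , A [0:= t ]) ∷ Γ) ≡ (R , subF (exts σ) A [0:= subT σ t ]) ∷ subSeq σ Γ
          eq = cong (λ B → (R , B) ∷ subSeq σ Γ) (subF-inst σ A t)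
  sub-MRLJ σ (All-pos {Γ} {R} {A = A} m i₁ i₂ d) =
    let d′ , e = recast eq (sub-MRLJ (exts σ) d)
    in All-pos m (≡.subst (Intu J) eq (Intu-sub (exts σ) i₁)) (Intu-sub σ i₂) d′ , cong suc e
    where eq : subSeq (exts σ) ((R , A) ∷ shift Γ) ≡ (R , subF (exts σ) A) ∷ shift (subSeq σ Γ)
          eq = cong ((R , subF (exts σ) A) ∷_) (subSeq-shift σ Γ)
  sub-MRLJ σ (Imp-neg m i₁ i₂ d) =
    let d′ , e = sub-MRLJ σ d in Imp-neg m (Intu-sub σ i₁) (Intu-sub σ i₂) d′ , cong suc e
  sub-MRLJ σ (Imp-pos {Γ₁} {Γ₂} {R} {f} {U} {A} {B} m i₁ i₂ i₃ d₁ d₂) =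
    let d₁′ , e₁ = sub-MRLJ σ d₁ ; d₂′ , e₂ = sub-MRLJ σ d₂
    in recast (≡.sym eq)
         (Imp-pos m (Intu-sub σ i₁) (Intu-sub σ i₂) (≡.subst (Intu J) eq (Intu-sub σ i₃)) d₁′ d₂′
         , cong suc (cong₂ _⊔_ e₁ e₂))
    where eq : subSeq σ ((R , imp f U A B) ∷ Γ₁ ++ Γ₂)
             ≡ (R , imp f U (subF σ A) (subF σ B)) ∷ subSeq σ Γ₁ ++ subSeq σ Γ₂
          eq = cong ((R , imp f U (subF σ A) (subF σ B)) ∷_) (List.map-++ (subIF σ) Γ₁ Γ₂)

  shift-MRLJ : ∀ {Γ} (d : MRLJ J Γ) → OfHeight (shift Γ) (height d)
  shift-MRLJ {Γ} d = recast (≡.sym (shift≡subSeq Γ)) (sub-MRLJ (var ∘ suc) d)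

  inst-MRLJ : ∀ t {R A Γ} (d : MRLJ J ((R , A) ∷ shift Γ)) → OfHeight ((R , A [0:= t ]) ∷ Γ) (height d)
  inst-MRLJ t {R} {A} {Γ} d =
    recast (cong ((R , A [0:= t ]) ∷_) (subSeq-inst-shift t Γ)) (sub-MRLJ (inst0 {Ω} t) d)

all-or-some : ∀ {a b n} {A : Fin n → Set a} {B : Fin n → Set b} →
              (∀ i → A i ⊎ B i) → (∀ i → A i) ⊎ Σ[ i ∈ Fin n ] B i
all-or-some {n = zero} f = inj₁ (λ ())
all-or-some {n = suc n} f with f zero | all-or-some (f ∘ suc)
... | inj₂ b | _            = inj₂ (zero , b)
... | inj₁ a | inj₁ as      = inj₁ λ { zero → a ; (suc i) → as i }
... | inj₁ _ | inj₂ (i , b) = inj₂ (suc i , b)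

override : ∀ {a n} {P : Fin n → Set a} → (∀ j → P j) → (i : Fin n) → P i → ∀ j → P j
override {n = suc n} ps zero x zero = x
override {n = suc n} ps zero x (suc j) = ps (suc j)
override {n = suc n} ps (suc i) x zero = ps zero
override {n = suc n} {P} ps (suc i) x (suc j) = override {P = P ∘ suc} (ps ∘ suc) i x j

override-same : ∀ {a n} {P : Fin n → Set a} (ps : ∀ j → P j) i x → override ps i x i ≡ x
override-same {n = suc n} ps zero x = ≡.refl
override-same {n = suc n} {P} ps (suc i) x = override-same {P = P ∘ suc} (ps ∘ suc) i x

override-other : ∀ {a n} {P : Fin n → Set a} (ps : ∀ j → P j) i x j → i ≢ j → override ps i x j ≡ ps j
override-other {n = suc n} ps zero x zero ne = ⊥-elim (ne ≡.refl)
override-other {n = suc n} ps zero x (suc j) ne = ≡.refl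
override-other {n = suc n} ps (suc i) x zero ne = ≡.refl
override-other {n = suc n} {P} ps (suc i) x (suc j) ne =
  override-other {P = P ∘ suc} (ps ∘ suc) i x j (ne ∘ cong suc)

sum-mono-≤ : ∀ {n} (h h′ : Fin n → ℕ) → (∀ j → h′ j ≤ h j) → sum h′ ≤ sum h
sum-mono-≤ {zero} h h′ f = z≤n
sum-mono-≤ {suc n} h h′ f = +-mono-≤ (f zero) (sum-mono-≤ (h ∘ suc) (h′ ∘ suc) (f ∘ suc))

sum-mono-< : ∀ {n} i (h h′ : Fin n → ℕ) → (∀ j → i ≢ j → h′ j ≤ h j) → h′ i < h i → sum h′ < sum h
sum-mono-< {suc n} zero h h′ f lt =
  +-mono-<-≤ lt (sum-mono-≤ (h ∘ suc) (h′ ∘ suc) (λ j → f (suc j) (λ ())))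
sum-mono-< {suc n} (suc i) h h′ f lt =
  +-mono-≤-< (f zero (λ ()))
             (sum-mono-< i (h ∘ suc) (h′ ∘ suc) (λ j ne → f (suc j) (ne ∘ suc-injective)) lt)

≤-sum : ∀ {n} i (h : Fin n → ℕ) → h i ≤ sum h
≤-sum zero h = m≤m+n (h zero) _
≤-sum (suc i) h = ≤-trans (≤-sum i (h ∘ suc)) (m≤n+m _ (h zero))

sum≡0 : ∀ {n} (h : Fin n → ℕ) → (∀ j → h j ≡ 0) → sum h ≡ 0
sum≡0 {zero} h f = ≡.refl
sum≡0 {suc n} h f = cong₂ _+_ (f zero) (sum≡0 (h ∘ suc) (f ∘ suc))

sum≡1 : ∀ {n} (h : Fin n → ℕ) i → h i ≡ 1 → (∀ j → i ≢ j → h j ≡ 0) → sum h ≡ 1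
sum≡1 h zero e f = cong₂ _+_ e (sum≡0 (h ∘ suc) (λ j → f (suc j) (λ ())))
sum≡1 h (suc i) e f = cong₂ _+_ (f zero (λ ())) (sum≡1 (h ∘ suc) i e (λ j ne → f (suc j) (ne ∘ suc-injective)))

2≤sum : ∀ {n} (h : Fin n → ℕ) i j → i ≢ j → 1 ≤ h i → 1 ≤ h j → 2 ≤ sum h
2≤sum h zero zero ne _ _ = ⊥-elim (ne ≡.refl)
2≤sum h zero (suc j) ne a b = +-mono-≤ a (≤-trans b (≤-sum j (h ∘ suc)))
2≤sum h (suc i) zero ne a b =
  ≡.subst (2 ≤_) (+-comm (sum (h ∘ suc)) (h zero)) (+-mono-≤ (≤-trans a (≤-sum i (h ∘ suc))) b)
2≤sum h (suc i) (suc j) ne a b = ≤-trans (2≤sum (h ∘ suc) i j (ne ∘ cong suc) a b) (m≤n+m _ (h zero))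

sum-positive : ∀ {n} (h : Fin n → ℕ) → 1 ≤ sum h → Σ[ i ∈ Fin n ] 1 ≤ h i
sum-positive {suc n} h p with h zero in eq
... | suc _ = zero , ≡.subst (1 ≤_) (≡.sym eq) (s≤s z≤n)
... | zero  = let i , q = sum-positive (h ∘ suc) p in suc i , q

<⊔ˡ : ∀ {a b h} → suc (a ⊔ b) ≡ h → a < h
<⊔ˡ eq = ≤-trans (s≤s (m≤m⊔n _ _)) (≤-reflexive eq)

<⊔ʳ : ∀ {a b h} → suc (a ⊔ b) ≡ h → b < h
<⊔ʳ eq = ≤-trans (s≤s (m≤n⊔m _ _)) (≤-reflexive eq)

module _ {Ω : Set} where

  concatF : ∀ {n} → (Fin n → Sequent Ω) → Sequent Ω
  concatF G = concat (tabulate G)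

  others : ∀ {n} → Fin n → (Fin n → Sequent Ω) → Sequent Ω
  others {suc n} zero G = concatF (G ∘ suc)
  others {suc n} (suc i) G = G zero ++ others i (G ∘ suc)

  concatF-split : ∀ {n} i (G : Fin n → Sequent Ω) → concatF G ↭ G i ++ others i G
  concatF-split zero G = ↭-refl
  concatF-split (suc i) G = trans (++⁺ˡ (G zero) (concatF-split i (G ∘ suc))) (shifts (G zero) (G (suc i)))

  concatF-cong : ∀ {n} {G G′ : Fin n → Sequent Ω} → (∀ j → G j ↭ G′ j) → concatF G ↭ concatF G′
  concatF-cong {zero} f = ↭-refl
  concatF-cong {suc n} f = ++⁺ (f zero) (concatF-cong (f ∘ suc))

  others-cong : ∀ {n} i {G G′ : Fin n → Sequent Ω} → (∀ j → i ≢ j → G j ↭ G′ j) →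
                others i G ↭ others i G′
  others-cong zero f = concatF-cong (λ j → f (suc j) (λ ()))
  others-cong (suc i) f = ++⁺ (f zero (λ ())) (others-cong i (λ j ne → f (suc j) (ne ∘ suc-injective)))

  concatF-split-agree : ∀ {n} i (G G′ : Fin n → Sequent Ω) → (∀ j → i ≢ j → G′ j ≡ G j) →
                        concatF G′ ↭ G′ i ++ others i G
  concatF-split-agree i G G′ f =
    trans (concatF-split i G′) (++⁺ˡ (G′ i) (others-cong i (λ j ne → ↭-reflexive (f j ne))))

  ++-interchange : ∀ (a b c d : Sequent Ω) → (a ++ b) ++ (c ++ d) ↭ (a ++ c) ++ (b ++ d)
  ++-interchange a b c d =
    trans (↭-reflexive (List.++-assoc a b (c ++ d)))
      (trans (++⁺ˡ a (shifts b c)) (↭-reflexive (≡.sym (List.++-assoc a c (b ++ d)))))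

  ++-swap-middle : ∀ (a o g : Sequent Ω) → (a ++ o) ++ g ↭ (a ++ g) ++ o
  ++-swap-middle a o g =
    trans (↭-reflexive (List.++-assoc a o g))
      (trans (++⁺ˡ a (++-comm o g)) (↭-reflexive (≡.sym (List.++-assoc a g o))))

  ++-gather-copies : ∀ x (a b o : Sequent Ω) → x ∷ (a ++ o) ++ (b ++ o) ↭ o ++ o ++ x ∷ a ++ b
  ++-gather-copies x a b o =
    trans (↭-prep x (trans (++-interchange a o b o) (++-comm (a ++ b) (o ++ o))))
      (trans (↭-sym (↭-shift (o ++ o) (a ++ b))) (↭-reflexive (List.++-assoc o o _)))

  concatF-++ : ∀ {n} (G H : Fin n → Sequent Ω) → concatF (λ j → G j ++ H j) ↭ concatF G ++ concatF H
  concatF-++ {zero} G H = ↭-refl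
  concatF-++ {suc n} G H =
    trans (++⁺ˡ (G zero ++ H zero) (concatF-++ (G ∘ suc) (H ∘ suc))) (++-interchange (G zero) (H zero) _ _)

  others-++ : ∀ {n} i (G H : Fin n → Sequent Ω) → others i (λ j → G j ++ H j) ↭ others i G ++ others i H
  others-++ zero G H = concatF-++ (G ∘ suc) (H ∘ suc)
  others-++ (suc i) G H =
    trans (++⁺ˡ (G zero ++ H zero) (others-++ i (G ∘ suc) (H ∘ suc))) (++-interchange (G zero) (H zero) _ _)

  concatF-shift : ∀ {n} (G : Fin n → Sequent Ω) → concatF (shift ∘ G) ≡ shift (concatF G)
  concatF-shift {zero} G = ≡.refl
  concatF-shift {suc n} G =
    ≡.trans (cong (shift (G zero) ++_) (concatF-shift (G ∘ suc))) (≡.sym (List.map-++ _ (G zero) _))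

  others-shift : ∀ {n} i (G : Fin n → Sequent Ω) → others i (shift ∘ G) ≡ shift (others i G)
  others-shift zero G = concatF-shift (G ∘ suc)
  others-shift (suc i) G =
    ≡.trans (cong (shift (G zero) ++_) (others-shift i (G ∘ suc))) (≡.sym (List.map-++ _ (G zero) _))

  All-concatF : ∀ {n p} {P : IFormula Ω → Set p} (G : Fin n → Sequent Ω) → (∀ j → All P (G j)) →
                All P (concatF G)
  All-concatF {zero} G f = []
  All-concatF {suc n} G f = All.++⁺ (f zero) (All-concatF (G ∘ suc) (f ∘ suc))

  All-others : ∀ {n p} {P : IFormula Ω → Set p} i (G : Fin n → Sequent Ω) → (∀ j → i ≢ j → All P (G j)) →
               All P (others i G)
  All-others zero G f = All-concatF (G ∘ suc) (λ j → f (suc j) (λ ()))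
  All-others (suc i) G f = All.++⁺ (f zero (λ ())) (All-others i (G ∘ suc) (λ j ne → f (suc j) (ne ∘ suc-injective)))

  copies : ℕ → Sequent Ω → Sequent Ω
  copies zero O = []
  copies (suc c) O = O ++ copies c O

  copies-+ : ∀ c d O → copies (c + d) O ↭ copies c O ++ copies d O
  copies-+ zero d O = ↭-refl
  copies-+ (suc c) d O = trans (++⁺ˡ O (copies-+ c d O)) (↭-reflexive (≡.sym (List.++-assoc O (copies c O) _)))

-- A selection marks occurrences of R{A} in a sequent; a multicut removes all marked ones at once.
data Selection {Ω : Set} (R : RoleSet Ω) (A : Formula Ω) : Sequent Ω → Set₁ where
  []   : Selection R A []
  keep : ∀ {x xs} → Selection R A xs → Selection R A (x ∷ xs)
  cut  : ∀ {x xs} → proj₁ x ≈ᴿ R → proj₂ x ≡ A → Selection R A xs → Selection R A (x ∷ xs)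

module _ {Ω : Set} {R : RoleSet Ω} {A : Formula Ω} where

  kept : ∀ {Γ} → Selection R A Γ → Sequent Ω
  kept [] = []
  kept (keep {x} s) = x ∷ kept s
  kept (cut _ _ s) = kept s

  #cut : ∀ {Γ} → Selection R A Γ → ℕ
  #cut [] = 0
  #cut (keep s) = #cut s
  #cut (cut _ _ s) = suc (#cut s)

  keepAll : ∀ Γ → Selection R A Γ
  keepAll [] = []
  keepAll (x ∷ Γ) = keep (keepAll Γ)

  kept-keepAll : ∀ Γ → kept (keepAll Γ) ≡ Γ
  kept-keepAll [] = ≡.refl
  kept-keepAll (x ∷ Γ) = cong (x ∷_) (kept-keepAll Γ)

  cutHead : ∀ Γ → Selection R A ((R , A) ∷ Γ)
  cutHead Γ = cut (λ _ → ≡.refl) ≡.refl (keepAll Γ)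

  kept-#cut≡0 : ∀ {Γ} (s : Selection R A Γ) → #cut s ≡ 0 → kept s ≡ Γ
  kept-#cut≡0 [] _ = ≡.refl
  kept-#cut≡0 (keep {x} s) e = cong (x ∷_) (kept-#cut≡0 s e)

  keep-++ : ∀ H {Γ} → Selection R A Γ → Selection R A (H ++ Γ)
  keep-++ [] s = s
  keep-++ (x ∷ H) s = keep (keep-++ H s)

  kept-keep-++ : ∀ H {Γ} (s : Selection R A Γ) → kept (keep-++ H s) ≡ H ++ kept s
  kept-keep-++ [] s = ≡.refl
  kept-keep-++ (x ∷ H) s = cong (x ∷_) (kept-keep-++ H s)

  #cut-keep-++ : ∀ H {Γ} (s : Selection R A Γ) → #cut (keep-++ H s) ≡ #cut s
  #cut-keep-++ [] s = ≡.refl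
  #cut-keep-++ (x ∷ H) s = #cut-keep-++ H s

  record SplitSelection (X Y : Sequent Ω) (s : Selection R A (X ++ Y)) : Set₁ where
    constructor splitting
    field
      left    : Selection R A X
      right   : Selection R A Y
      kept-++ : kept s ≡ kept left ++ kept right
      #cut-+  : #cut s ≡ #cut left + #cut right

  split-selection : ∀ X {Y} (s : Selection R A (X ++ Y)) → SplitSelection X Y s
  split-selection [] s = splitting [] s ≡.refl ≡.refl
  split-selection (x ∷ X) (keep s) =
    let splitting s₁ s₂ k c = split-selection X s in splitting (keep s₁) s₂ (cong (x ∷_) k) c
  split-selection (x ∷ X) (cut e q s) =
    let splitting s₁ s₂ k c = split-selection X s in splitting (cut e q s₁) s₂ k (cong suc c)

  record Transported (Γ : Sequent Ω) {Δ} (s : Selection R A Δ) : Set₁ where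
    constructor transported
    field
      selection : Selection R A Γ
      kept-↭    : kept selection ↭ kept s
      #cut-≡    : #cut selection ≡ #cut s

  ≈ᵢ-cut : ∀ {x y} → x ≈ᵢ y → proj₁ y ≈ᴿ R → proj₂ y ≡ A → proj₁ x ≈ᴿ R × proj₂ x ≡ A
  ≈ᵢ-cut (e , q) e′ q′ = (λ r → ≡.trans (e r) (e′ r)) , ≡.trans q q′

  transport-Pointwise : ∀ {Γ Δ} → Pointwise _≈ᵢ_ Γ Δ → (s : Selection R A Δ) → Transported Γ s
  transport-Pointwise [] [] = transported [] ↭-refl ≡.refl
  transport-Pointwise (e ∷ pw) (keep s) =
    let transported s′ k c = transport-Pointwise pw s in transported (keep s′) (prep e k) c
  transport-Pointwise (e ∷ pw) (cut e′ q s) =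
    let transported s′ k c = transport-Pointwise pw s ; e″ , q″ = ≈ᵢ-cut e e′ q
    in transported (cut e″ q″ s′) k (cong suc c)

  transport-↭ : ∀ {Γ Δ} → Γ ↭ Δ → (s : Selection R A Δ) → Transported Γ s
  transport-↭ (refl pw) s = transport-Pointwise pw s
  transport-↭ (prep e p) (keep s) =
    let transported s′ k c = transport-↭ p s in transported (keep s′) (prep e k) c
  transport-↭ (prep e p) (cut e′ q s) =
    let transported s′ k c = transport-↭ p s ; e″ , q″ = ≈ᵢ-cut e e′ q
    in transported (cut e″ q″ s′) k (cong suc c)
  transport-↭ (swap e₁ e₂ p) (keep (keep s)) =
    let transported s′ k c = transport-↭ p s in transported (keep (keep s′)) (swap e₁ e₂ k) c
  transport-↭ (swap e₁ e₂ p) (keep (cut e′ q s)) =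
    let transported s′ k c = transport-↭ p s ; e″ , q″ = ≈ᵢ-cut e₁ e′ q
    in transported (cut e″ q″ (keep s′)) (prep e₂ k) (cong suc c)
  transport-↭ (swap e₁ e₂ p) (cut e′ q (keep s)) =
    let transported s′ k c = transport-↭ p s ; e″ , q″ = ≈ᵢ-cut e₂ e′ q
    in transported (keep (cut e″ q″ s′)) (prep e₁ k) (cong suc c)
  transport-↭ (swap e₁ e₂ p) (cut e′ q (cut e‴ q‴ s)) =
    let transported s′ k c = transport-↭ p s
        e″ , q″ = ≈ᵢ-cut e₂ e′ q
        f″ , g″ = ≈ᵢ-cut e₁ e‴ q‴
    in transported (cut f″ g″ (cut e″ q″ s′)) k (cong (λ k → suc (suc k)) c)
  transport-↭ (trans p₁ p₂) s =
    let transported s₂ k₂ c₂ = transport-↭ p₂ s ; transported s₁ k₁ c₁ = transport-↭ p₁ s₂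
    in transported s₁ (trans k₁ k₂) (≡.trans c₁ c₂)

module _ {Ω : Set} {R : RoleSet Ω} {A : Formula Ω} where

  shift-selection : ∀ {Γ} → Selection R A Γ → Selection R (renF suc A) (shift Γ)
  shift-selection [] = []
  shift-selection (keep s) = keep (shift-selection s)
  shift-selection (cut e q s) = cut e (cong (renF suc) q) (shift-selection s)

  kept-shift : ∀ {Γ} (s : Selection R A Γ) → kept (shift-selection s) ≡ shift (kept s)
  kept-shift [] = ≡.refl
  kept-shift (keep s) = cong (_ ∷_) (kept-shift s)
  kept-shift (cut e q s) = kept-shift s

  #cut-shift : ∀ {Γ} (s : Selection R A Γ) → #cut (shift-selection s) ≡ #cut s
  #cut-shift [] = ≡.refl
  #cut-shift (keep s) = #cut-shift s
  #cut-shift (cut e q s) = cong suc (#cut-shift s)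

  All-kept : ∀ {p} {P : IFormula Ω → Set p} {Γ} → All P Γ → (s : Selection R A Γ) → All P (kept s)
  All-kept [] [] = []
  All-kept (p ∷ f) (keep s) = p ∷ All-kept f s
  All-kept (p ∷ f) (cut _ _ s) = All-kept f s

  module _ (J : Ultrafilter Ω) where

    JFree⇒R∉J : ∀ {Γ} → JFree J Γ → (s : Selection R A Γ) → 1 ≤ #cut s → ¬ Mem J R
    JFree⇒R∉J (p ∷ f) (keep s) c = JFree⇒R∉J f s c
    JFree⇒R∉J (p ∷ f) (cut e _ s) c m = p (Mem-resp J (≡.sym ∘ e) m)

    Intu-kept : ∀ {Γ} → Intu J Γ → (s : Selection R A Γ) → Intu J (kept s)
    Intu-kept [] [] = []
    Intu-kept (no∷ n i) (keep s) = no∷ n (Intu-kept i s)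
    Intu-kept (yes∷ p f) (keep s) = yes∷ p (All-kept f s)
    Intu-kept i (cut _ _ s) = Intu-kept (Intu-tail J i) s

    R∈J⇒kept-JFree : ∀ {Γ} → Intu J Γ → (s : Selection R A Γ) → 1 ≤ #cut s → Mem J R → JFree J (kept s)
    R∈J⇒kept-JFree [] [] () m
    R∈J⇒kept-JFree (no∷ n i) (keep s) c m = n ∷ R∈J⇒kept-JFree i s c m
    R∈J⇒kept-JFree (yes∷ p f) (keep s) c m = ⊥-elim (JFree⇒R∉J f s c m)
    R∈J⇒kept-JFree i (cut e _ s) c m = All-kept (Intu-head J i (Mem-resp J (≡.sym ∘ e) m)) s

    cut-again⇒R∉J : ∀ {x Γ} → Intu J (x ∷ Γ) → proj₁ x ≈ᴿ R → (s : Selection R A Γ) → 1 ≤ #cut s →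
                    ¬ Mem J R
    cut-again⇒R∉J i e s c m = JFree⇒R∉J (Intu-head J i (Mem-resp J (≡.sym ∘ e) m)) s c m

    2≤#cut⇒R∉J : ∀ {Γ} → Intu J Γ → (s : Selection R A Γ) → 2 ≤ #cut s → ¬ Mem J R
    2≤#cut⇒R∉J i (keep s) c = 2≤#cut⇒R∉J (Intu-tail J i) s c
    2≤#cut⇒R∉J i (cut e _ s) (s≤s c) = cut-again⇒R∉J i e s c

    kept-JFree-or-R∉J : ∀ {Γ} → Intu J Γ → (s : Selection R A Γ) → 1 ≤ #cut s →
                        JFree J (kept s) ⊎ (¬ Mem J R × Intu J (kept s))
    kept-JFree-or-R∉J (no∷ n i) (keep s) c with kept-JFree-or-R∉J i s c
    ... | inj₁ f = inj₁ (n ∷ f)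
    ... | inj₂ (nm , i′) = inj₂ (nm , no∷ n i′)
    kept-JFree-or-R∉J (yes∷ p f) (keep s) c = inj₂ (JFree⇒R∉J f s c , yes∷ p (All-kept f s))
    kept-JFree-or-R∉J (no∷ n i) (cut e _ s) c = inj₂ (n ∘ Mem-resp J (≡.sym ∘ e) , Intu-kept i s)
    kept-JFree-or-R∉J (yes∷ p f) (cut e _ s) c = inj₁ (All-kept f s)

indicator : Bool → ℕ
indicator true = 1
indicator false = 0

1≤indicator⇒true : ∀ {b} → 1 ≤ indicator b → b ≡ true
1≤indicator⇒true {true} _ = ≡.refl

module _ {Ω : Set} where

  count : Ω → Sequent Ω → ℕ
  count r [] = 0
  count r ((R , _) ∷ Γ) = indicator (R r) + count r Γ

  count-++ : ∀ r X Y → count r (X ++ Y) ≡ count r X + count r Y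
  count-++ r [] Y = ≡.refl
  count-++ r ((R , _) ∷ X) Y =
    ≡.trans (cong (indicator (R r) +_) (count-++ r X Y)) (≡.sym (+-assoc (indicator (R r)) _ _))

  count-concatF : ∀ {n} r (G : Fin n → Sequent Ω) → count r (concatF G) ≡ sum (λ i → count r (G i))
  count-concatF {zero} r G = ≡.refl
  count-concatF {suc n} r G =
    ≡.trans (count-++ r (G zero) _) (cong (count r (G zero) +_) (count-concatF r (G ∘ suc)))

  count-tabulate : ∀ {n} r (Rs : Fin n → RoleSet Ω) (F : Fin n → Formula Ω) →
                   count r (tabulate (λ l → Rs l , F l)) ≡ sum (λ l → indicator (Rs l r))
  count-tabulate {zero} r Rs F = ≡.refl
  count-tabulate {suc n} r Rs F = cong (indicator (Rs zero r) +_) (count-tabulate r (Rs ∘ suc) (F ∘ suc))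

  count-lookup : ∀ r (Γ : Sequent Ω) → count r Γ ≡ sum (λ l → indicator (proj₁ (lookup Γ l) r))
  count-lookup r [] = ≡.refl
  count-lookup r ((R , _) ∷ Γ) = cong (indicator (R r) +_) (count-lookup r Γ)

  tabulate-lookup-atom : ∀ {a} (Γ : Sequent Ω) → All (λ x → proj₂ x ≡ atom a) Γ →
                         Γ ≡ tabulate (λ l → proj₁ (lookup Γ l) , atom a)
  tabulate-lookup-atom [] [] = ≡.refl
  tabulate-lookup-atom (x ∷ Γ) (≡.refl ∷ f) = cong (x ∷_) (tabulate-lookup-atom Γ f)

  All-tabulate-atom : ∀ {n} (Rs : Fin n → RoleSet Ω) a →
                      All (λ x → proj₂ x ≡ atom a) (tabulate {A = IFormula Ω} (λ l → Rs l , atom a))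
  All-tabulate-atom {zero} Rs a = []
  All-tabulate-atom {suc n} Rs a = ≡.refl ∷ All-tabulate-atom (Rs ∘ suc) a

  module _ {R : RoleSet Ω} {A : Formula Ω} where

    count-kept-∈ : ∀ r {Γ} (s : Selection R A Γ) → R r ≡ true → count r Γ ≡ #cut s + count r (kept s)
    count-kept-∈ r [] t = ≡.refl
    count-kept-∈ r (keep {R′ , _} s) t =
      ≡.trans (cong (indicator (R′ r) +_) (count-kept-∈ r s t)) (x∙yz≈y∙xz (indicator (R′ r)) (#cut s) _)
    count-kept-∈ r (cut e _ s) t rewrite e r | t = cong suc (count-kept-∈ r s t)

    count-kept-∉ : ∀ r {Γ} (s : Selection R A Γ) → R r ≡ false → count r Γ ≡ count r (kept s)
    count-kept-∉ r [] t = ≡.refl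
    count-kept-∉ r (keep {R′ , _} s) t = cong (indicator (R′ r) +_) (count-kept-∉ r s t)
    count-kept-∉ r (cut e _ s) t rewrite e r | t = count-kept-∉ r s t

    selection-atom : ∀ {n} {Rs : Fin n → RoleSet Ω} {a} (s : Selection R A (tabulate (λ l → Rs l , atom a))) →
                     1 ≤ #cut s → A ≡ atom a
    selection-atom {zero} [] ()
    selection-atom {suc n} (keep s) c = selection-atom s c
    selection-atom {suc n} (cut e q s) c = ≡.sym q

  Partition⇒sum≡1 : ∀ {n} (Rs : Fin n → RoleSet Ω) → Partition Rs →
                    ∀ r → sum (λ i → indicator (Rs i r)) ≡ 1
  Partition⇒sum≡1 Rs (disjoint , covers) r =
    let i , r∈Rsᵢ = covers r in sum≡1 _ i (cong indicator r∈Rsᵢ) (outside i r∈Rsᵢ)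
    where outside : ∀ i → Rs i r ≡ true → ∀ j → i ≢ j → indicator (Rs j r) ≡ 0
          outside i r∈Rsᵢ j ne with Rs j r in r∈Rsⱼ
          ... | true = ⊥-elim (disjoint i j ne r (r∈Rsᵢ , r∈Rsⱼ))
          ... | false = ≡.refl

  sum≡1⇒Partition : ∀ {n} (Rs : Fin n → RoleSet Ω) → (∀ r → sum (λ i → indicator (Rs i r)) ≡ 1) →
                    Partition Rs
  sum≡1⇒Partition Rs one = disjoint , covers
    where
      1≤ind : ∀ {b} → b ≡ true → 1 ≤ indicator b
      1≤ind ≡.refl = s≤s z≤n
      disjoint : ∀ i j → i ≢ j → ∀ r → ¬ (Rs i r ≡ true × Rs j r ≡ true)
      disjoint i j ne r (tᵢ , tⱼ) with ≡.subst (2 ≤_) (one r) (2≤sum _ i j ne (1≤ind tᵢ) (1≤ind tⱼ))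
      ... | s≤s ()
      covers : ∀ r → ∃[ i ] Rs i r ≡ true
      covers r =
        let i , p = sum-positive (λ l → indicator (Rs l r)) (≡.subst (1 ≤_) (≡.sym (one r)) (s≤s z≤n))
        in i , 1≤indicator⇒true p

-- Multicuts

∧≡true : ∀ a b → a ∧ b ≡ true → a ≡ true × b ≡ true
∧≡true true true _ = ≡.refl , ≡.refl

module _ {Ω : Set} where

  CoPartition : ∀ {n} → (Fin n → RoleSet Ω) → Set
  CoPartition Rs = Partition (∁ ∘ Rs)

  preimage-CoPartition : ∀ {n} {Rs : Fin n → RoleSet Ω} f → CoPartition Rs → CoPartition (preimage f ∘ Rs)
  preimage-CoPartition f (disjoint , covers) = (λ i j ne r → disjoint i j ne (f r)) , covers ∘ f

  -- ∁ (Rs i) ∩ ∁ (Rs j) is empty, so U cannot contain both.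
  ∉-unique : ∀ {n} {Rs : Fin n → RoleSet Ω} → CoPartition Rs →
             ∀ (U : Ultrafilter Ω) {i j} → i ≢ j → ¬ Mem U (Rs i) → Mem U (Rs j)
  ∉-unique {Rs = Rs} (disjoint , _) U {i} {j} ne Rsᵢ∉U with ultra U (Rs i) | ultra U (Rs j)
  ... | inj₁ Rsᵢ∈U | _ = ⊥-elim (Rsᵢ∉U Rsᵢ∈U)
  ... | inj₂ _ | inj₁ Rsⱼ∈U = Rsⱼ∈U
  ... | inj₂ ∁Rsᵢ∈U | inj₂ ∁Rsⱼ∈U = upward U empty (inter U ∁Rsᵢ∈U ∁Rsⱼ∈U)
    where empty : ∀ r → (∁ (Rs i) ∩ ∁ (Rs j)) r ≡ true → Rs j r ≡ true
          empty r e = ⊥-elim (disjoint i j ne r (∧≡true _ _ e))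

module _ {Ω : Set} (J : Ultrafilter Ω) where

  JFree-copies : ∀ c {O} → JFree J O → JFree J (copies c O)
  JFree-copies zero f = []
  JFree-copies (suc c) f = All.++⁺ f (JFree-copies c f)

  contract-copies : ∀ c O {W} → MRLJ J (copies c O ++ O ++ W) → JFree J O → Intu J (O ++ W) → MRLJ J (O ++ W)
  contract-copies zero O d f i = d
  contract-copies (suc c) O {W} d f i =
    contract-++ J O (contract-copies c O {O ++ W} d′ f (JFree-++-Intu J f i)) f i
    where d′ : MRLJ J (copies c O ++ O ++ O ++ W)
          d′ = mset (trans (↭-reflexive (List.++-assoc O (copies c O) (O ++ W))) (shifts O (copies c O))) d

  record CutPremise (R : RoleSet Ω) (A : Formula Ω) : Set₁ where
    constructor premise
    field
      {sequent}  : Sequent Ω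
      derivation : MRLJ J sequent
      selection  : Selection R A sequent
      1≤#cut     : 1 ≤ #cut selection
  open CutPremise public

  cutHead-premise : ∀ {R A} Γ → MRLJ J ((R , A) ∷ Γ) → CutPremise R A
  cutHead-premise Γ d = premise d (cutHead Γ) (s≤s z≤n)

  remainder : ∀ {R A} → CutPremise R A → Sequent Ω
  remainder p = kept (selection p)

  heightP : ∀ {R A} → CutPremise R A → ℕ
  heightP p = height J (derivation p)

  shift-premise : ∀ {R A} → CutPremise R A → CutPremise R (renF suc A)
  shift-premise (premise d s c) =
    premise (proj₁ (shift-MRLJ J d)) (shift-selection s) (≡.subst (1 ≤_) (≡.sym (#cut-shift s)) c)

  heightP-shift : ∀ {R A} (p : CutPremise R A) → heightP (shift-premise p) ≡ heightP p
  heightP-shift (premise d s c) = proj₂ (shift-MRLJ J d)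

  remainder-shift : ∀ {R A} (p : CutPremise R A) → remainder (shift-premise p) ≡ shift (remainder p)
  remainder-shift (premise d s c) = kept-shift s

  -- The last rule of a premise of height h with remainder X introduces one of its cut occurrences;
  -- s selects the cut occurrences left in the rule's context, and if there are any, R ∉ J.
  data Principal (R : RoleSet Ω) (A : Formula Ω) (X : Sequent Ω) (h : ℕ) : Set₁ where
    by-Id : ∀ {m} (Rs′ : Fin m → RoleSet Ω) (a : Atom) → Partition Rs′ →
            (s : Selection R A (tabulate (λ l → Rs′ l , atom a))) → 1 ≤ #cut s → kept s ≡ X →
            Principal R A X h
    by-Neg : ∀ {R′ f B Γ} → R′ ≈ᴿ R → neg f B ≡ A →
             (s : Selection R A Γ) → kept s ≡ X → (1 ≤ #cut s → ¬ Mem J R) →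
             (d : MRLJ J ((preimage f R′ , B) ∷ Γ)) → height J d < h → Principal R A X h
    by-And-neg-l : ∀ {R′ U B C Γ} → ¬ Mem U R′ → R′ ≈ᴿ R → and U B C ≡ A →
                   (s : Selection R A Γ) → kept s ≡ X → (1 ≤ #cut s → ¬ Mem J R) →
                   (d : MRLJ J ((R′ , B) ∷ Γ)) → height J d < h → Principal R A X h
    by-And-neg-r : ∀ {R′ U B C Γ} → ¬ Mem U R′ → R′ ≈ᴿ R → and U B C ≡ A →
                   (s : Selection R A Γ) → kept s ≡ X → (1 ≤ #cut s → ¬ Mem J R) →
                   (d : MRLJ J ((R′ , C) ∷ Γ)) → height J d < h → Principal R A X h
    by-And-pos : ∀ {R′ U B C Γ} → Mem U R′ → R′ ≈ᴿ R → and U B C ≡ A →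
                 (s : Selection R A Γ) → kept s ≡ X → (1 ≤ #cut s → ¬ Mem J R) →
                 (d₁ : MRLJ J ((R′ , B) ∷ Γ)) → height J d₁ < h →
                 (d₂ : MRLJ J ((R′ , C) ∷ Γ)) → height J d₂ < h → Principal R A X h
    by-All-neg : ∀ {R′ U B Γ} (t : Term) → ¬ Mem U R′ → R′ ≈ᴿ R → all U B ≡ A →
                 (s : Selection R A Γ) → kept s ≡ X → (1 ≤ #cut s → ¬ Mem J R) →
                 (d : MRLJ J ((R′ , B [0:= t ]) ∷ Γ)) → height J d < h → Principal R A X h
    by-All-pos : ∀ {R′ U B Γ} → Mem U R′ → R′ ≈ᴿ R → all U B ≡ A →
                 (s : Selection R A Γ) → kept s ≡ X → (1 ≤ #cut s → ¬ Mem J R) →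
                 (d : MRLJ J ((R′ , B) ∷ shift Γ)) → height J d < h → Principal R A X h
    by-Imp-neg : ∀ {R′ f U B C Γ} → ¬ Mem U R′ → R′ ≈ᴿ R → imp f U B C ≡ A →
                 (s : Selection R A Γ) → kept s ≡ X → (1 ≤ #cut s → ¬ Mem J R) →
                 (d : MRLJ J ((preimage f R′ , B) ∷ (R′ , C) ∷ Γ)) → height J d < h → Principal R A X h
    by-Imp-pos : ∀ {R′ f U B C Γ₁ Γ₂} → Mem U R′ → R′ ≈ᴿ R → imp f U B C ≡ A →
                 (s₁ : Selection R A Γ₁) (s₂ : Selection R A Γ₂) → kept s₁ ++ kept s₂ ≡ X →
                 (1 ≤ #cut s₁ + #cut s₂ → ¬ Mem J R) →
                 (d₁ : MRLJ J ((preimage f R′ , B) ∷ Γ₁)) → height J d₁ < h →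
                 (d₂ : MRLJ J ((R′ , C) ∷ Γ₂)) → height J d₂ < h → Principal R A X h

  MulticutBelow : ℕ → Set₁
  MulticutBelow k = ∀ {m} (Rs′ : Fin m → RoleSet Ω) → CoPartition Rs′ → (A′ : Formula Ω) → size A′ < k →
                    (ps′ : ∀ i → CutPremise (Rs′ i) A′) → MRLJ J (concatF (remainder ∘ ps′))

  -- X i is what premise i contributes to the conclusion, O i what all the other premises contribute.
  module MulticutContext {n} (Rs : Fin n → RoleSet Ω) (copart : CoPartition Rs)
                         (A : Formula Ω) (ps : (i : Fin n) → CutPremise (Rs i) A) where

    X : Fin n → Sequent Ω
    X i = remainder (ps i)

    O : Fin n → Sequent Ω
    O i = others i X

    Conclusion : Sequent Ω
    Conclusion = concatF X

    Goal : Set₁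
    Goal = MRLJ J Conclusion

    R∉J⇒others-JFree : ∀ i → ¬ Mem J (Rs i) → JFree J (O i)
    R∉J⇒others-JFree i Rsᵢ∉J = All-others i X λ j ne →
      R∈J⇒kept-JFree J (MRLJ⇒Intu J (derivation (ps j))) (selection (ps j)) (1≤#cut (ps j))
                       (∉-unique copart J ne Rsᵢ∉J)

    Conclusion-Intu : Intu J Conclusion
    Conclusion-Intu
      with all-or-some (λ i → kept-JFree-or-R∉J J (MRLJ⇒Intu J (derivation (ps i))) (selection (ps i)) (1≤#cut (ps i)))
    ... | inj₁ f = JFree⇒Intu J (All-concatF X f)
    ... | inj₂ (i , Rsᵢ∉J , Xᵢ-Intu) =
      Intu-resp-↭ J (↭-sym (concatF-split i X)) (Intu-++-JFree J Xᵢ-Intu (R∉J⇒others-JFree i Rsᵢ∉J))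

    Intu-with-others : ∀ {i Y} → Y ↭ X i → Intu J (Y ++ O i)
    Intu-with-others {i} Y↭Xᵢ =
      Intu-resp-↭ J (trans (concatF-split i X) (++⁺ʳ (O i) (↭-sym Y↭Xᵢ))) Conclusion-Intu

    conclude : ∀ {i W Y} → MRLJ J W → W ↭ Y ++ O i → Y ↭ X i → Goal
    conclude {i} d W↭ Y↭Xᵢ = mset (trans W↭ (trans (++⁺ʳ (O i) Y↭Xᵢ) (↭-sym (concatF-split i X)))) d

    HeightIH : Set₁
    HeightIH = ∀ (A′ : Formula Ω) → size A′ ≡ size A → (ps′ : ∀ i → CutPremise (Rs i) A′) →
               sum (heightP ∘ ps′) < sum (heightP ∘ ps) → MRLJ J (concatF (remainder ∘ ps′))

    SizeIH : Set₁
    SizeIH = MulticutBelow (size A)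

    -- Replacing one premise by a lower one decreases the total height.
    cut-lower-premise : HeightIH → ∀ i (p : CutPremise (Rs i) A) → heightP p < heightP (ps i) →
                        MRLJ J (remainder p ++ O i)
    cut-lower-premise ih i p lt =
      mset (trans (concatF-split-agree i X (remainder ∘ ps′) (λ j ne → cong remainder (override-other ps i p j ne)))
                  (↭-reflexive (cong (λ q → remainder q ++ O i) (override-same ps i p))))
           (ih A ≡.refl ps′ sum<)
      where
        ps′ : ∀ j → CutPremise (Rs j) A
        ps′ = override ps i p
        sum< : sum (heightP ∘ ps′) < sum (heightP ∘ ps)
        sum< = sum-mono-< i (heightP ∘ ps) (heightP ∘ ps′)
                 (λ j ne → ≤-reflexive (cong heightP (override-other ps i p j ne)))
                 (≡.subst (_< heightP (ps i)) (≡.sym (cong heightP (override-same ps i p))) lt)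

  module LastRule {n} (Rs : Fin n → RoleSet Ω) (copart : CoPartition Rs) (A : Formula Ω)
                  (ps : (i : Fin n) → CutPremise (Rs i) A) (ih : MulticutContext.HeightIH Rs copart A ps) where
    open MulticutContext Rs copart A ps

    PrincipalAt : Fin n → Set₁
    PrincipalAt i = Principal (Rs i) A (X i) (heightP (ps i))

    cut-above : ∀ i {Γ} (d : MRLJ J Γ) (s : Selection (Rs i) A Γ) → 1 ≤ #cut s → height J d < heightP (ps i) →
                MRLJ J (kept s ++ O i)
    cut-above i d s c = cut-lower-premise ih i (premise d s c)

    permute-unary : ∀ i {Γ y} P (s : Selection (Rs i) A Γ) → 1 ≤ #cut s →
                    (d : MRLJ J (P ++ Γ)) → height J d < heightP (ps i) →
                    (∀ {Θ} → Intu J (P ++ Θ) → Intu J (y ∷ Θ) → MRLJ J (P ++ Θ) → MRLJ J (y ∷ Θ)) →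
                    y ∷ kept s ≡ X i → Goal
    permute-unary i P s c d lt rule eq =
      conclude (rule (MRLJ⇒Intu J d′) (Intu-with-others (↭-reflexive eq)) d′) ↭-refl (↭-reflexive eq)
      where d′ : MRLJ J (P ++ kept s ++ O i)
            d′ = cast J (≡.trans (cong (_++ O i) (kept-keep-++ P s)) (List.++-assoc P (kept s) (O i)))
                   (cut-above i d (keep-++ P s) (≡.subst (1 ≤_) (≡.sym (#cut-keep-++ P s)) c) lt)

    permute-binary : ∀ i {Γ x₁ x₂ y} (s : Selection (Rs i) A Γ) → 1 ≤ #cut s →
                     (d₁ : MRLJ J (x₁ ∷ Γ)) → height J d₁ < heightP (ps i) →
                     (d₂ : MRLJ J (x₂ ∷ Γ)) → height J d₂ < heightP (ps i) →
                     (∀ {Θ} → Intu J (x₁ ∷ Θ) → Intu J (x₂ ∷ Θ) → Intu J (y ∷ Θ) →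
                              MRLJ J (x₁ ∷ Θ) → MRLJ J (x₂ ∷ Θ) → MRLJ J (y ∷ Θ)) →
                     y ∷ kept s ≡ X i → Goal
    permute-binary i {x₁ = x₁} {x₂} s c d₁ lt₁ d₂ lt₂ rule eq =
      conclude (rule (MRLJ⇒Intu J d₁′) (MRLJ⇒Intu J d₂′) (Intu-with-others (↭-reflexive eq)) d₁′ d₂′)
               ↭-refl (↭-reflexive eq)
      where d₁′ : MRLJ J (x₁ ∷ kept s ++ O i)
            d₁′ = cut-above i d₁ (keep s) c lt₁
            d₂′ : MRLJ J (x₂ ∷ kept s ++ O i)
            d₂′ = cut-above i d₂ (keep s) c lt₂

    -- The eigenvariable condition is restored by shifting every premise, which changes neither
    -- heights nor the size of the cut formula.
    permute-All-pos : ∀ i {Γ R′ U B} → Mem U R′ → (d : MRLJ J ((R′ , B) ∷ shift Γ)) →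
                      (s : Selection (Rs i) A Γ) → 1 ≤ #cut s → height J d < heightP (ps i) →
                      (R′ , all U B) ∷ kept s ≡ X i → Goal
    permute-All-pos i {Γ} {R′} {U} {B} m d s c lt eq =
      conclude (All-pos m (MRLJ⇒Intu J d′) (Intu-with-others (↭-reflexive eq)) d′) ↭-refl (↭-reflexive eq)
      where
        p′ : CutPremise (Rs i) (renF suc A)
        p′ = premise d (keep (shift-selection s)) (≡.subst (1 ≤_) (≡.sym (#cut-shift s)) c)
        shifted ps′ : ∀ j → CutPremise (Rs j) (renF suc A)
        shifted = shift-premise ∘ ps
        ps′ = override shifted i p′
        sum< : sum (heightP ∘ ps′) < sum (heightP ∘ ps)
        sum< = sum-mono-< i (heightP ∘ ps) (heightP ∘ ps′)
                 (λ j ne → ≤-reflexive (≡.trans (cong heightP (override-other shifted i p′ j ne))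
                                                 (heightP-shift (ps j))))
                 (≡.subst (_< heightP (ps i)) (≡.sym (cong heightP (override-same shifted i p′))) lt)
        ↭shifted : concatF (remainder ∘ ps′) ↭ (R′ , B) ∷ shift (kept s ++ O i)
        ↭shifted =
          trans (concatF-split-agree i (remainder ∘ shifted) (remainder ∘ ps′)
                                     (λ j ne → cong remainder (override-other shifted i p′ j ne)))
          (trans (↭-reflexive (cong (λ q → remainder q ++ others i (remainder ∘ shifted))
                                    (override-same shifted i p′)))
          (trans (++⁺ˡ ((R′ , B) ∷ kept (shift-selection s))
                       (others-cong i (λ j _ → ↭-reflexive (remainder-shift (ps j)))))
                 (↭-reflexive (cong ((R′ , B) ∷_) (≡.trans (cong₂ _++_ (kept-shift s) (others-shift i X))
                                                             (≡.sym (List.map-++ _ (kept s) (O i))))))))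
        d′ : MRLJ J ((R′ , B) ∷ shift (kept s ++ O i))
        d′ = mset ↭shifted (ih (renF suc A) (size-renF suc A) ps′ sum<)

    -- If cut occurrences lie on both sides, there are at least two of them, so Rs i ∉ J and the two
    -- copies of O i are J-free and can be contracted.
    permute-Imp-pos : ∀ i {Γ₁ Γ₂ R′ f U B C} → Mem U R′ →
                      (d₁ : MRLJ J ((preimage f R′ , B) ∷ Γ₁)) → height J d₁ < heightP (ps i) →
                      (d₂ : MRLJ J ((R′ , C) ∷ Γ₂)) → height J d₂ < heightP (ps i) →
                      (s : Selection (Rs i) A (Γ₁ ++ Γ₂)) → 1 ≤ #cut s →
                      Intu J ((R′ , imp f U B C) ∷ Γ₁ ++ Γ₂) → (R′ , imp f U B C) ∷ kept s ≡ X i → Goal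
    permute-Imp-pos i {Γ₁} {Γ₂} {R′} {f} {U} {B} {C} m d₁ lt₁ d₂ lt₂ s c intu eq
      with split-selection Γ₁ s
    ... | splitting s₁ s₂ kept≡ #cut≡ = by-cuts (#cut s₁) ≡.refl (#cut s₂) ≡.refl
      where
        y : IFormula Ω
        y = (R′ , imp f U B C)
        Y↭Xᵢ : ∀ {Y₁ Y₂} → Y₁ ≡ kept s₁ → Y₂ ≡ kept s₂ → y ∷ Y₁ ++ Y₂ ↭ X i
        Y↭Xᵢ ≡.refl ≡.refl = ↭-reflexive (≡.trans (cong (y ∷_) (≡.sym kept≡)) eq)
        by-cuts : ∀ k₁ → #cut s₁ ≡ k₁ → ∀ k₂ → #cut s₂ ≡ k₂ → Goal
        by-cuts zero e₁ zero e₂ with ≡.subst (1 ≤_) (≡.trans #cut≡ (cong₂ _+_ e₁ e₂)) c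
        ... | ()
        by-cuts zero e₁ (suc _) e₂ =
          conclude d (↭-reflexive (cong (y ∷_) (≡.sym (List.++-assoc Γ₁ (kept s₂) (O i))))) Y↭
          where
            Y↭ : y ∷ Γ₁ ++ kept s₂ ↭ X i
            Y↭ = Y↭Xᵢ (≡.sym (kept-#cut≡0 s₁ e₁)) ≡.refl
            d₂′ : MRLJ J ((R′ , C) ∷ kept s₂ ++ O i)
            d₂′ = cut-above i d₂ (keep s₂) (≡.subst (1 ≤_) (≡.sym e₂) (s≤s z≤n)) lt₂
            d : MRLJ J (y ∷ Γ₁ ++ kept s₂ ++ O i)
            d = Imp-pos m (MRLJ⇒Intu J d₁) (MRLJ⇒Intu J d₂′)
                  (Intu-resp-↭ J (↭-reflexive (cong (y ∷_) (List.++-assoc Γ₁ (kept s₂) (O i))))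
                                 (Intu-with-others Y↭))
                  d₁ d₂′
        by-cuts (suc _) e₁ zero e₂ = conclude d (↭-prep y (++-swap-middle (kept s₁) (O i) Γ₂)) Y↭
          where
            Y↭ : y ∷ kept s₁ ++ Γ₂ ↭ X i
            Y↭ = Y↭Xᵢ ≡.refl (≡.sym (kept-#cut≡0 s₂ e₂))
            d₁′ : MRLJ J ((preimage f R′ , B) ∷ kept s₁ ++ O i)
            d₁′ = cut-above i d₁ (keep s₁) (≡.subst (1 ≤_) (≡.sym e₁) (s≤s z≤n)) lt₁
            d : MRLJ J (y ∷ (kept s₁ ++ O i) ++ Γ₂)
            d = Imp-pos m (MRLJ⇒Intu J d₁′) (MRLJ⇒Intu J d₂)
                  (Intu-resp-↭ J (↭-prep y (↭-sym (++-swap-middle (kept s₁) (O i) Γ₂))) (Intu-with-others Y↭))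
                  d₁′ d₂
        by-cuts (suc k₁) e₁ (suc k₂) e₂ = conclude d (++-comm (O i) Y) Y↭
          where
            Y : Sequent Ω
            Y = y ∷ kept s₁ ++ kept s₂
            Y↭ : Y ↭ X i
            Y↭ = Y↭Xᵢ ≡.refl ≡.refl
            two : 2 ≤ #cut (keep {x = y} s)
            two = ≡.subst (2 ≤_) (≡.sym (≡.trans #cut≡ (cong₂ _+_ e₁ e₂)))
                          (s≤s (≤-trans (s≤s z≤n) (m≤n+m (suc k₂) k₁)))
            Oᵢ-JFree : JFree J (O i)
            Oᵢ-JFree = R∉J⇒others-JFree i (2≤#cut⇒R∉J J intu (keep s) two)
            d₁′ : MRLJ J ((preimage f R′ , B) ∷ kept s₁ ++ O i)
            d₁′ = cut-above i d₁ (keep s₁) (≡.subst (1 ≤_) (≡.sym e₁) (s≤s z≤n)) lt₁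
            d₂′ : MRLJ J ((R′ , C) ∷ kept s₂ ++ O i)
            d₂′ = cut-above i d₂ (keep s₂) (≡.subst (1 ≤_) (≡.sym e₂) (s≤s z≤n)) lt₂
            OY-Intu : Intu J (O i ++ Y)
            OY-Intu = Intu-resp-↭ J (++-comm Y (O i)) (Intu-with-others Y↭)
            both : MRLJ J (y ∷ (kept s₁ ++ O i) ++ (kept s₂ ++ O i))
            both = Imp-pos m (MRLJ⇒Intu J d₁′) (MRLJ⇒Intu J d₂′)
                     (Intu-resp-↭ J (↭-sym (++-gather-copies y (kept s₁) (kept s₂) (O i)))
                                    (JFree-++-Intu J Oᵢ-JFree OY-Intu))
                     d₁′ d₂′
            d : MRLJ J (O i ++ Y)
            d = contract-++ J (O i) (mset (++-gather-copies y (kept s₁) (kept s₂) (O i)) both) Oᵢ-JFree OY-Intu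

    permute-or-principal-at : ∀ i {Γ} (d : MRLJ J Γ) (s : Selection (Rs i) A Γ) → 1 ≤ #cut s →
                              height J d ≡ heightP (ps i) → kept s ≡ X i → Goal ⊎ PrincipalAt i
    permute-or-principal-at i (mset p d) s c h eq =
      let transported s′ k e = transport-↭ p s
      in inj₁ (conclude (cut-above i d s′ (≡.subst (1 ≤_) (≡.sym e) c) (≤-reflexive h)) ↭-refl
                        (trans k (↭-reflexive eq)))
    permute-or-principal-at i (Id Rs′ a pt _) s c h eq = inj₂ (by-Id Rs′ a pt s c eq)
    permute-or-principal-at i (Weaken _ _ d) (keep s) c h eq =
      inj₁ (permute-unary i [] s c d (≤-reflexive h) Weaken eq)
    permute-or-principal-at i (Weaken {Γ} _ _ d) (cut _ _ s) c h eq with #cut s in e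
    ... | zero = inj₁ (conclude (weaken-++ʳ J (O i) d (Intu-with-others Γ↭Xᵢ)) ↭-refl Γ↭Xᵢ)
      where Γ↭Xᵢ : Γ ↭ X i
            Γ↭Xᵢ = ↭-reflexive (≡.trans (≡.sym (kept-#cut≡0 s e)) eq)
    ... | suc _ = inj₁ (conclude (cut-above i d s (≡.subst (1 ≤_) (≡.sym e) (s≤s z≤n)) (≤-reflexive h))
                                 ↭-refl (↭-reflexive eq))
    permute-or-principal-at i (Contract _ _ d) (keep s) c h eq =
      inj₁ (permute-unary i (_ ∷ _ ∷ []) s c d (≤-reflexive h) Contract eq)
    permute-or-principal-at i (Contract _ _ d) (cut e q s) c h eq =
      inj₁ (conclude (cut-above i d (cut e q (cut e q s)) (s≤s z≤n) (≤-reflexive h)) ↭-refl (↭-reflexive eq))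
    permute-or-principal-at i (Neg _ _ d) (keep s) c h eq =
      inj₁ (permute-unary i (_ ∷ []) s c d (≤-reflexive h) Neg eq)
    permute-or-principal-at i (Neg _ intu d) (cut e q s) c h eq =
      inj₂ (by-Neg e q s eq (cut-again⇒R∉J J intu e s) d (≤-reflexive h))
    permute-or-principal-at i (And-neg-l m _ _ d) (keep s) c h eq =
      inj₁ (permute-unary i (_ ∷ []) s c d (≤-reflexive h) (And-neg-l m) eq)
    permute-or-principal-at i (And-neg-l m _ intu d) (cut e q s) c h eq =
      inj₂ (by-And-neg-l m e q s eq (cut-again⇒R∉J J intu e s) d (≤-reflexive h))
    permute-or-principal-at i (And-neg-r m _ _ d) (keep s) c h eq =
      inj₁ (permute-unary i (_ ∷ []) s c d (≤-reflexive h) (And-neg-r m) eq)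
    permute-or-principal-at i (And-neg-r m _ intu d) (cut e q s) c h eq =
      inj₂ (by-And-neg-r m e q s eq (cut-again⇒R∉J J intu e s) d (≤-reflexive h))
    permute-or-principal-at i (And-pos m _ _ _ d₁ d₂) (keep s) c h eq =
      inj₁ (permute-binary i s c d₁ (<⊔ˡ h) d₂ (<⊔ʳ h) (And-pos m) eq)
    permute-or-principal-at i (And-pos m _ _ intu d₁ d₂) (cut e q s) c h eq =
      inj₂ (by-And-pos m e q s eq (cut-again⇒R∉J J intu e s) d₁ (<⊔ˡ h) d₂ (<⊔ʳ h))
    permute-or-principal-at i (All-neg t m _ _ d) (keep s) c h eq =
      inj₁ (permute-unary i (_ ∷ []) s c d (≤-reflexive h) (All-neg t m) eq)
    permute-or-principal-at i (All-neg t m _ intu d) (cut e q s) c h eq =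
      inj₂ (by-All-neg t m e q s eq (cut-again⇒R∉J J intu e s) d (≤-reflexive h))
    permute-or-principal-at i (All-pos m _ _ d) (keep s) c h eq =
      inj₁ (permute-All-pos i m d s c (≤-reflexive h) eq)
    permute-or-principal-at i (All-pos m _ intu d) (cut e q s) c h eq =
      inj₂ (by-All-pos m e q s eq (cut-again⇒R∉J J intu e s) d (≤-reflexive h))
    permute-or-principal-at i (Imp-neg m _ _ d) (keep s) c h eq =
      inj₁ (permute-unary i (_ ∷ _ ∷ []) s c d (≤-reflexive h) (Imp-neg m) eq)
    permute-or-principal-at i (Imp-neg m _ intu d) (cut e q s) c h eq =
      inj₂ (by-Imp-neg m e q s eq (cut-again⇒R∉J J intu e s) d (≤-reflexive h))
    permute-or-principal-at i (Imp-pos m _ _ intu d₁ d₂) (keep s) c h eq =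
      inj₁ (permute-Imp-pos i m d₁ (<⊔ˡ h) d₂ (<⊔ʳ h) s c intu eq)
    permute-or-principal-at i (Imp-pos {Γ₁} m _ _ intu d₁ d₂) (cut e q s) c h eq =
      let splitting s₁ s₂ kept≡ #cut≡ = split-selection Γ₁ s
      in inj₂ (by-Imp-pos m e q s₁ s₂ (≡.trans (≡.sym kept≡) eq)
                 (cut-again⇒R∉J J intu e s ∘ ≡.subst (1 ≤_) (≡.sym #cut≡)) d₁ (<⊔ˡ h) d₂ (<⊔ʳ h))

    permute-or-principal : Goal ⊎ (∀ i → PrincipalAt i)
    permute-or-principal with all-or-some (λ i → ⊎-swap (permute-or-principal-at i (derivation (ps i))
                                                        (selection (ps i)) (1≤#cut (ps i)) ≡.refl ≡.refl))
    ... | inj₁ principal = inj₂ principal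
    ... | inj₂ (_ , goal) = inj₁ goal

  fill : ∀ {a n} {P : Fin n → Set a} k → P k → (∀ i → i ≢ k → P i) → ∀ i → P i
  fill k x f i with i ≟ k
  ... | yes ≡.refl = x
  ... | no i≢k = f i i≢k

  at-most-one-negative : ∀ {ℓ n} {Rs : Fin n → RoleSet Ω} → CoPartition Rs → (U : Ultrafilter Ω) →
                         {N P : Fin n → Set ℓ} → (∀ i → N i → ¬ Mem U (Rs i)) → (∀ i → N i ⊎ P i) →
                         (∀ i → P i) ⊎ Σ[ k ∈ Fin n ] N k × (∀ i → i ≢ k → P i)
  at-most-one-negative copart U negative view with all-or-some (⊎-swap ∘ view)
  ... | inj₁ positive = inj₁ positive
  ... | inj₂ (k , Nₖ) = inj₂ (k , Nₖ , positive)
    where positive : ∀ i → i ≢ k → _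
          positive i i≢k with view i
          ... | inj₁ Nᵢ = ⊥-elim (negative i Nᵢ (∉-unique copart U (i≢k ∘ ≡.sym) (negative k Nₖ)))
          ... | inj₂ Pᵢ = Pᵢ

  module Reduction {n} (Rs : Fin n → RoleSet Ω) (copart : CoPartition Rs) (A : Formula Ω)
                   (ps : (i : Fin n) → CutPremise (Rs i) A)
                   (ih : MulticutContext.HeightIH Rs copart A ps) (ih-size : MulticutContext.SizeIH Rs copart A ps) where
    open MulticutContext Rs copart A ps
    open LastRule Rs copart A ps ih

    -- The copies of O i can be contracted in the end because there are none or Rs i ∉ J.
    record WithCopies (i : Fin n) (Z Y : Sequent Ω) : Set₁ where
      constructor with-copies
      field
        #copies      : ℕ
        ↭copies      : Y ↭ Z ++ copies #copies (O i)
        contractible : #copies ≡ 0 ⊎ ¬ Mem J (Rs i)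

    record Mixed (i : Fin n) (H Z : Sequent Ω) : Set₁ where
      constructor mixed
      field
        {rest} : Sequent Ω
        proof  : MRLJ J (H ++ rest)
        tally  : WithCopies i Z rest

    Reduced : Fin n → IFormula Ω → Set₁
    Reduced i x = Mixed i (x ∷ []) (X i)

    cut-remaining : ∀ i H {Γ} (s : Selection (Rs i) A Γ) → (1 ≤ #cut s → ¬ Mem J (Rs i)) →
                    (d : MRLJ J (H ++ Γ)) → height J d < heightP (ps i) → Mixed i H (kept s)
    cut-remaining i H {Γ} s Rsᵢ∉J d lt with #cut s in e
    ... | zero = mixed d (with-copies 0 (↭-reflexive (≡.trans (≡.sym (kept-#cut≡0 s e))
                                                              (≡.sym (List.++-identityʳ (kept s)))))
                                        (inj₁ ≡.refl))
    ... | suc _ = mixed (cast J (List.++-assoc H (kept s) (O i)) d′)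
                        (with-copies 1 (++⁺ˡ (kept s) (↭-sym (++-identityʳ (O i)))) (inj₂ (Rsᵢ∉J (s≤s z≤n))))
      where
        1≤ : 1 ≤ #cut s
        1≤ = ≡.subst (1 ≤_) (≡.sym e) (s≤s z≤n)
        d′ : MRLJ J ((H ++ kept s) ++ O i)
        d′ = cast J (cong (_++ O i) (kept-keep-++ H s))
                    (cut-above i d (keep-++ H s) (≡.subst (1 ≤_) (≡.sym (#cut-keep-++ H s)) 1≤) lt)

    reduced : ∀ {i H′ H Z} → Mixed i H′ Z → Z ≡ X i → Pointwise _≈ᵢ_ H′ H → Mixed i H (X i)
    reduced (mixed d w) ≡.refl H′≈H = mixed (mset (++⁺ʳ _ (refl H′≈H)) d) w

    cut-reduced-premises : (Rs′ : Fin n → RoleSet Ω) → CoPartition Rs′ → (B : Formula Ω) → size B < size A →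
                           (rs : ∀ i → Reduced i (Rs′ i , B)) → MRLJ J (concatF (λ i → Mixed.rest (rs i)))
    cut-reduced-premises Rs′ copart′ B lt rs =
      mset (concatF-cong (λ i → ↭-reflexive (kept-keepAll (Mixed.rest (rs i)))))
           (ih-size Rs′ copart′ B lt (λ i → cutHead-premise _ (Mixed.proof (rs i))))

    -- Only one premise can carry copies, since copies require Rs i ∉ J.
    Duplicates : (Fin n → Sequent Ω) → Set₁
    Duplicates Ys = (concatF Ys ↭ Conclusion)
                  ⊎ Σ[ p ∈ Fin n ] Σ[ c ∈ ℕ ] JFree J (O p) × (concatF Ys ↭ copies c (O p) ++ O p ++ X p)

    no-copies : ∀ {i Y} (w : WithCopies i (X i) Y) → WithCopies.#copies w ≡ 0 → Y ↭ X i
    no-copies (with-copies _ Y↭ _) ≡.refl = trans Y↭ (↭-reflexive (List.++-identityʳ _))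

    copies-unique : ∀ {p j Y} → p ≢ j → ¬ Mem J (Rs p) → WithCopies j (X j) Y → Y ↭ X j
    copies-unique _ _ w@(with-copies _ _ (inj₁ none)) = no-copies w none
    copies-unique ne Rsₚ∉J (with-copies _ _ (inj₂ Rsⱼ∉J)) = ⊥-elim (Rsⱼ∉J (∉-unique copart J ne Rsₚ∉J))

    duplicates : (Ys : Fin n → Sequent Ω) → (∀ i → WithCopies i (X i) (Ys i)) → Duplicates Ys
    duplicates Ys ws with all-or-some (WithCopies.contractible ∘ ws)
    ... | inj₁ none = inj₁ (concatF-cong (λ i → no-copies (ws i) (none i)))
    ... | inj₂ (p , Rsₚ∉J) with ws p
    ... | with-copies c Yₚ↭ _ = inj₂ (p , c , R∉J⇒others-JFree p Rsₚ∉J ,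
            trans (concatF-split p Ys)
            (trans (++⁺ Yₚ↭ (others-cong p (λ j ne → copies-unique ne Rsₚ∉J (ws j))))
            (trans (++⁺ʳ (O p) (++-comm (X p) (copies c (O p))))
            (trans (↭-reflexive (List.++-assoc (copies c (O p)) (X p) (O p)))
                   (++⁺ˡ (copies c (O p)) (++-comm (X p) (O p)))))))

    Intu-O++X : ∀ p → Intu J (O p ++ X p)
    Intu-O++X p = Intu-resp-↭ J (++-comm (X p) (O p)) (Intu-with-others ↭-refl)

    contract-duplicates : ∀ {Ys} → MRLJ J (concatF Ys) → Duplicates Ys → Goal
    contract-duplicates d (inj₁ ↭C) = mset ↭C d
    contract-duplicates d (inj₂ (p , c , Oₚ-JFree , ↭C)) =
      conclude (contract-copies c (O p) (mset ↭C d) Oₚ-JFree (Intu-O++X p)) (++-comm (O p) (X p)) ↭-refl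

    Duplicates-Intu : ∀ {Ys} → Duplicates Ys → Intu J (concatF Ys)
    Duplicates-Intu (inj₁ ↭C) = Intu-resp-↭ J (↭-sym ↭C) Conclusion-Intu
    Duplicates-Intu (inj₂ (p , c , Oₚ-JFree , ↭C)) =
      Intu-resp-↭ J (↭-sym ↭C) (JFree-++-Intu J (JFree-copies c Oₚ-JFree) (Intu-O++X p))

    cut-reduced : (Rs′ : Fin n → RoleSet Ω) → CoPartition Rs′ → (B : Formula Ω) → size B < size A →
                  (∀ i → Reduced i (Rs′ i , B)) → Goal
    cut-reduced Rs′ copart′ B lt rs =
      contract-duplicates (cut-reduced-premises Rs′ copart′ B lt rs)
        (duplicates (Mixed.rest ∘ rs) (Mixed.tally ∘ rs))

  -- Principal cases

  1≤m⇒m+n≡1⇒n≡0 : ∀ {m n} → 1 ≤ m → m + n ≡ 1 → n ≡ 0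
  1≤m⇒m+n≡1⇒n≡0 {suc zero} {zero} _ _ = ≡.refl

  -- Every premise is an instance of Id cut on an atom, so the remainders of the premises together
  -- contain every role exactly once: they form an instance of Id again.
  module AtomCase {n} (Rs : Fin n → RoleSet Ω) (copart : CoPartition Rs) (a : Atom)
                  (ps : (i : Fin n) → CutPremise (Rs i) (atom a)) where
    open MulticutContext Rs copart (atom a) ps

    record AtomicRemainder (i : Fin n) : Set₁ where
      field
        atoms  : All (λ x → proj₂ x ≡ atom a) (X i)
        count≡ : ∀ r → count r (X i) ≡ indicator (∁ (Rs i) r)

    atomic : ∀ i → Principal (Rs i) (atom a) (X i) (heightP (ps i)) → AtomicRemainder i
    atomic i (by-Id Rs′ a′ pt s c eq) with selection-atom s c
    ... | ≡.refl = record { atoms = ≡.subst (All _) eq (All-kept (All-tabulate-atom Rs′ a) s) ; count≡ = count≡ }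
      where
        one : ∀ r → count r (tabulate {A = IFormula Ω} (λ l → Rs′ l , atom a)) ≡ 1
        one r = ≡.trans (count-tabulate r Rs′ (λ _ → atom a)) (Partition⇒sum≡1 Rs′ pt r)
        count≡ : ∀ r → count r (X i) ≡ indicator (∁ (Rs i) r)
        count≡ r rewrite ≡.sym eq with Rs i r in r∈?
        ... | true = 1≤m⇒m+n≡1⇒n≡0 c (≡.trans (≡.sym (count-kept-∈ r s r∈?)) (one r))
        ... | false = ≡.trans (≡.sym (count-kept-∉ r s r∈?)) (one r)
    atomic i (by-Neg _ () _ _ _ _ _)
    atomic i (by-And-neg-l _ _ () _ _ _ _ _)
    atomic i (by-And-neg-r _ _ () _ _ _ _ _)
    atomic i (by-And-pos _ _ () _ _ _ _ _ _ _)
    atomic i (by-All-neg _ _ _ () _ _ _ _ _)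
    atomic i (by-All-pos _ _ () _ _ _ _ _)
    atomic i (by-Imp-neg _ _ () _ _ _ _ _)
    atomic i (by-Imp-pos _ _ () _ _ _ _ _ _ _ _)

    principal-atom : (∀ i → Principal (Rs i) (atom a) (X i) (heightP (ps i))) → Goal
    principal-atom principal =
      cast J (≡.sym Conclusion≡Id) (Id roles a roles-Partition (≡.subst (Intu J) Conclusion≡Id Conclusion-Intu))
      where
        remainders : ∀ i → AtomicRemainder i
        remainders i = atomic i (principal i)
        roles : Fin _ → RoleSet Ω
        roles l = proj₁ (lookup Conclusion l)
        count≡1 : ∀ r → count r Conclusion ≡ 1
        count≡1 r = ≡.trans (count-concatF r X)
                      (≡.trans (sum-cong-≗ (λ i → AtomicRemainder.count≡ (remainders i) r))
                               (Partition⇒sum≡1 (∁ ∘ Rs) copart r))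
        roles-Partition : Partition roles
        roles-Partition = sum≡1⇒Partition roles (λ r → ≡.trans (≡.sym (count-lookup r Conclusion)) (count≡1 r))
        Conclusion≡Id : Conclusion ≡ tabulate (λ l → roles l , atom a)
        Conclusion≡Id = tabulate-lookup-atom Conclusion (All-concatF X (AtomicRemainder.atoms ∘ remainders))

  module NegCase {n} (Rs : Fin n → RoleSet Ω) (copart : CoPartition Rs) (f : Ω → Ω) (B : Formula Ω)
                 (ps : (i : Fin n) → CutPremise (Rs i) (neg f B))
                 (ih : MulticutContext.HeightIH Rs copart (neg f B) ps)
                 (ih-size : MulticutContext.SizeIH Rs copart (neg f B) ps) where
    open MulticutContext Rs copart (neg f B) ps
    open LastRule Rs copart (neg f B) ps ih
    open Reduction Rs copart (neg f B) ps ih ih-size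

    reduce : ∀ i → PrincipalAt i → Reduced i (preimage f (Rs i) , B)
    reduce i (by-Id _ _ _ s c _) with selection-atom s c
    ... | ()
    reduce i (by-Neg {R′} e ≡.refl s eq Rsᵢ∉J d lt) =
      reduced (cut-remaining i ((preimage f R′ , B) ∷ []) s Rsᵢ∉J d lt) eq ((e ∘ f , ≡.refl) ∷ [])
    reduce i (by-And-neg-l _ _ () _ _ _ _ _)
    reduce i (by-And-neg-r _ _ () _ _ _ _ _)
    reduce i (by-And-pos _ _ () _ _ _ _ _ _ _)
    reduce i (by-All-neg _ _ _ () _ _ _ _ _)
    reduce i (by-All-pos _ _ () _ _ _ _ _)
    reduce i (by-Imp-neg _ _ () _ _ _ _ _)
    reduce i (by-Imp-pos _ _ () _ _ _ _ _ _ _ _)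

    principal-neg : (∀ i → PrincipalAt i) → Goal
    principal-neg principal =
      cut-reduced (preimage f ∘ Rs) (preimage-CoPartition f copart) B ≤-refl (λ i → reduce i (principal i))

  module AndCase {n} (Rs : Fin n → RoleSet Ω) (copart : CoPartition Rs) (U : Ultrafilter Ω) (B C : Formula Ω)
                 (ps : (i : Fin n) → CutPremise (Rs i) (and U B C))
                 (ih : MulticutContext.HeightIH Rs copart (and U B C) ps)
                 (ih-size : MulticutContext.SizeIH Rs copart (and U B C) ps) where
    open MulticutContext Rs copart (and U B C) ps
    open LastRule Rs copart (and U B C) ps ih
    open Reduction Rs copart (and U B C) ps ih ih-size

    Negative Positive : Fin n → Set₁
    Negative i = ¬ Mem U (Rs i) × (Reduced i (Rs i , B) ⊎ Reduced i (Rs i , C))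
    Positive i = Reduced i (Rs i , B) × Reduced i (Rs i , C)

    view : ∀ i → PrincipalAt i → Negative i ⊎ Positive i
    view i (by-Id _ _ _ s c _) with selection-atom s c
    ... | ()
    view i (by-And-neg-l {R′} R′∉U e ≡.refl s eq Rsᵢ∉J d lt) =
      inj₁ (R′∉U ∘ Mem-resp U (≡.sym ∘ e) ,
            inj₁ (reduced (cut-remaining i ((R′ , B) ∷ []) s Rsᵢ∉J d lt) eq ((e , ≡.refl) ∷ [])))
    view i (by-And-neg-r {R′} R′∉U e ≡.refl s eq Rsᵢ∉J d lt) =
      inj₁ (R′∉U ∘ Mem-resp U (≡.sym ∘ e) ,
            inj₂ (reduced (cut-remaining i ((R′ , C) ∷ []) s Rsᵢ∉J d lt) eq ((e , ≡.refl) ∷ [])))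
    view i (by-And-pos {R′} _ e ≡.refl s eq Rsᵢ∉J d₁ lt₁ d₂ lt₂) =
      inj₂ (reduced (cut-remaining i ((R′ , B) ∷ []) s Rsᵢ∉J d₁ lt₁) eq ((e , ≡.refl) ∷ []) ,
            reduced (cut-remaining i ((R′ , C) ∷ []) s Rsᵢ∉J d₂ lt₂) eq ((e , ≡.refl) ∷ []))
    view i (by-Neg _ () _ _ _ _ _)
    view i (by-All-neg _ _ _ () _ _ _ _ _)
    view i (by-All-pos _ _ () _ _ _ _ _)
    view i (by-Imp-neg _ _ () _ _ _ _ _)
    view i (by-Imp-pos _ _ () _ _ _ _ _ _ _ _)

    -- The negative premise, if any, decides which conjunct is cut.
    principal-and : (∀ i → PrincipalAt i) → Goal
    principal-and principal with at-most-one-negative copart U (λ _ → proj₁) (λ i → view i (principal i))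
    ... | inj₁ positive = cut-reduced Rs copart B (s≤s (m≤m⊔n _ _)) (proj₁ ∘ positive)
    ... | inj₂ (k , (_ , inj₁ Bₖ) , positive) =
      cut-reduced Rs copart B (s≤s (m≤m⊔n _ _)) (fill k Bₖ (λ i → proj₁ ∘ positive i))
    ... | inj₂ (k , (_ , inj₂ Cₖ) , positive) =
      cut-reduced Rs copart C (s≤s (m≤n⊔m _ _)) (fill k Cₖ (λ i → proj₂ ∘ positive i))

  module AllCase {n} (Rs : Fin n → RoleSet Ω) (copart : CoPartition Rs) (U : Ultrafilter Ω) (B : Formula Ω)
                 (ps : (i : Fin n) → CutPremise (Rs i) (all U B))
                 (ih : MulticutContext.HeightIH Rs copart (all U B) ps)
                 (ih-size : MulticutContext.SizeIH Rs copart (all U B) ps) where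
    open MulticutContext Rs copart (all U B) ps
    open LastRule Rs copart (all U B) ps ih
    open Reduction Rs copart (all U B) ps ih ih-size

    Negative Positive : Fin n → Set₁
    Negative i = Σ[ t ∈ Term ] ¬ Mem U (Rs i) × Reduced i (Rs i , B [0:= t ])
    Positive i = ∀ t → Reduced i (Rs i , B [0:= t ])

    view : ∀ i → PrincipalAt i → Negative i ⊎ Positive i
    view i (by-Id _ _ _ s c _) with selection-atom s c
    ... | ()
    view i (by-All-neg {R′} t R′∉U e ≡.refl s eq Rsᵢ∉J d lt) =
      inj₁ (t , R′∉U ∘ Mem-resp U (≡.sym ∘ e) ,
            reduced (cut-remaining i ((R′ , B [0:= t ]) ∷ []) s Rsᵢ∉J d lt) eq ((e , ≡.refl) ∷ []))
    view i (by-All-pos {R′} _ e ≡.refl s eq Rsᵢ∉J d lt) = inj₂ λ t →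
      let d′ , h≡ = inst-MRLJ J t d
      in reduced (cut-remaining i ((R′ , B [0:= t ]) ∷ []) s Rsᵢ∉J d′
                                (≡.subst (_< heightP (ps i)) (≡.sym h≡) lt))
                 eq ((e , ≡.refl) ∷ [])
    view i (by-Neg _ () _ _ _ _ _)
    view i (by-And-neg-l _ _ () _ _ _ _ _)
    view i (by-And-neg-r _ _ () _ _ _ _ _)
    view i (by-And-pos _ _ () _ _ _ _ _ _ _)
    view i (by-Imp-neg _ _ () _ _ _ _ _)
    view i (by-Imp-pos _ _ () _ _ _ _ _ _ _ _)

    instance< : ∀ t → size (B [0:= t ]) < size (all U B)
    instance< t = s≤s (≤-reflexive (size-subF _ B))

    -- The negative premise, if any, fixes the instantiating term; any term does otherwise.
    principal-all : (∀ i → PrincipalAt i) → Goal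
    principal-all principal with at-most-one-negative copart U (λ _ → proj₁ ∘ proj₂) (λ i → view i (principal i))
    ... | inj₁ positive = cut-reduced Rs copart _ (instance< (var 0)) (λ i → positive i (var 0))
    ... | inj₂ (k , (t , _ , Bₖ) , positive) =
      cut-reduced Rs copart _ (instance< t) (fill k Bₖ (λ i i≢k → positive i i≢k t))

  module ImpCase {n} (Rs : Fin n → RoleSet Ω) (copart : CoPartition Rs) (f : Ω → Ω) (U : Ultrafilter Ω)
                 (B C : Formula Ω) (ps : (i : Fin n) → CutPremise (Rs i) (imp f U B C))
                 (ih : MulticutContext.HeightIH Rs copart (imp f U B C) ps)
                 (ih-size : MulticutContext.SizeIH Rs copart (imp f U B C) ps) where
    open MulticutContext Rs copart (imp f U B C) ps
    open LastRule Rs copart (imp f U B C) ps ih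
    open Reduction Rs copart (imp f U B C) ps ih ih-size

    B< : size B < size (imp f U B C)
    B< = s≤s (m≤m⊔n _ _)

    C< : size C < size (imp f U B C)
    C< = s≤s (m≤n⊔m _ _)

    Negative : Fin n → Set₁
    Negative i = ¬ Mem U (Rs i) × Mixed i ((preimage f (Rs i) , B) ∷ (Rs i , C) ∷ []) (X i)

    record Positive (i : Fin n) : Set₁ where
      constructor positive
      field
        {Y₁ Y₂} : Sequent Ω
        left    : MRLJ J ((preimage f (Rs i) , B) ∷ Y₁)
        right   : MRLJ J ((Rs i , C) ∷ Y₂)
        tally   : WithCopies i (X i) (Y₁ ++ Y₂)

    contractible-+ : ∀ {i c₁ c₂} → c₁ ≡ 0 ⊎ ¬ Mem J (Rs i) → c₂ ≡ 0 ⊎ ¬ Mem J (Rs i) →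
                     c₁ + c₂ ≡ 0 ⊎ ¬ Mem J (Rs i)
    contractible-+ (inj₁ ≡.refl) ok₂ = ok₂
    contractible-+ (inj₂ Rsᵢ∉J) _ = inj₂ Rsᵢ∉J

    view : ∀ i → PrincipalAt i → Negative i ⊎ Positive i
    view i (by-Id _ _ _ s c _) with selection-atom s c
    ... | ()
    view i (by-Imp-neg {R′} R′∉U e ≡.refl s eq Rsᵢ∉J d lt) =
      inj₁ (R′∉U ∘ Mem-resp U (≡.sym ∘ e) ,
            reduced (cut-remaining i ((preimage f R′ , B) ∷ (R′ , C) ∷ []) s Rsᵢ∉J d lt) eq
                    ((e ∘ f , ≡.refl) ∷ (e , ≡.refl) ∷ []))
    view i (by-Imp-pos {R′} _ e ≡.refl s₁ s₂ eq Rsᵢ∉J d₁ lt₁ d₂ lt₂)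
      with cut-remaining i ((preimage f R′ , B) ∷ []) s₁ (Rsᵢ∉J ∘ λ c → ≤-trans c (m≤m+n _ _)) d₁ lt₁
         | cut-remaining i ((R′ , C) ∷ []) s₂ (Rsᵢ∉J ∘ λ c → ≤-trans c (m≤n+m _ _)) d₂ lt₂
    ... | mixed d₁′ (with-copies c₁ r₁↭ ok₁) | mixed d₂′ (with-copies c₂ r₂↭ ok₂) =
      inj₂ (positive (mset (prep (e ∘ f , ≡.refl) ↭-refl) d₁′) (mset (prep (e , ≡.refl) ↭-refl) d₂′)
              (with-copies (c₁ + c₂)
                (trans (++⁺ r₁↭ r₂↭) (trans (++-interchange (kept s₁) _ (kept s₂) _)
                                            (++⁺ (↭-reflexive eq) (↭-sym (copies-+ c₁ c₂ (O i))))))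
                (contractible-+ ok₁ ok₂)))
    view i (by-Neg _ () _ _ _ _ _)
    view i (by-And-neg-l _ _ () _ _ _ _ _)
    view i (by-And-neg-r _ _ () _ _ _ _ _)
    view i (by-And-pos _ _ () _ _ _ _ _ _ _)
    view i (by-All-neg _ _ _ () _ _ _ _ _)
    view i (by-All-pos _ _ () _ _ _ _ _)

    -- With every premise positive, cutting the consequents C suffices; the antecedent
    -- contexts are weakened in.
    all-positive : (∀ i → Positive i) → Goal
    all-positive P = contract-duplicates d dups
      where
        Y₁s Y₂s Ys : Fin n → Sequent Ω
        Y₁s i = Positive.Y₁ (P i)
        Y₂s i = Positive.Y₂ (P i)
        Ys i = Y₁s i ++ Y₂s i
        cut-C : MRLJ J (concatF Y₂s)
        cut-C = mset (concatF-cong (λ i → ↭-reflexive (kept-keepAll (Y₂s i))))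
                     (ih-size Rs copart C C< (λ i → cutHead-premise _ (Positive.right (P i))))
        ↭Ys : concatF Y₂s ++ concatF Y₁s ↭ concatF Ys
        ↭Ys = trans (++-comm (concatF Y₂s) (concatF Y₁s)) (↭-sym (concatF-++ Y₁s Y₂s))
        dups : Duplicates Ys
        dups = duplicates Ys (Positive.tally ∘ P)
        d : MRLJ J (concatF Ys)
        d = mset ↭Ys (weaken-++ʳ J _ cut-C (Intu-resp-↭ J (↭-sym ↭Ys) (Duplicates-Intu dups)))

    -- With a negative premise at k, first cut C (using its C-occurrence at k), then cut B
    -- (using at k the B-occurrence that survives the first cut).
    module OneNegative (k : Fin n) (N : Negative k) (P : ∀ i → i ≢ k → Positive i) where
      Nₖ : Mixed k ((preimage f (Rs k) , B) ∷ (Rs k , C) ∷ []) (X k)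
      Nₖ = proj₂ N

      which : ∀ i → i ≡ k ⊎ (i ≢ k × Positive i)
      which i with i ≟ k
      ... | yes i≡k = inj₁ i≡k
      ... | no i≢k = inj₂ (i≢k , P i i≢k)

      C-premise : ∀ i → i ≡ k ⊎ (i ≢ k × Positive i) → CutPremise (Rs i) C
      C-premise .k (inj₁ ≡.refl) =
        premise (mset (swap ≈ᵢ-refl ≈ᵢ-refl ↭-refl) (Mixed.proof Nₖ))
                (cut (λ _ → ≡.refl) ≡.refl (keep (keepAll _))) (s≤s z≤n)
      C-premise i (inj₂ (_ , Pᵢ)) = cutHead-premise _ (Positive.right Pᵢ)

      CR : Fin n → Sequent Ω
      CR i = remainder (C-premise i (which i))

      CRₖ : CR k ↭ (preimage f (Rs k) , B) ∷ Mixed.rest Nₖ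
      CRₖ with which k
      ... | inj₁ ≡.refl = ↭-reflexive (cong (_ ∷_) (kept-keepAll _))
      ... | inj₂ (k≢k , _) = ⊥-elim (k≢k ≡.refl)

      cut-C : MRLJ J ((preimage f (Rs k) , B) ∷ Mixed.rest Nₖ ++ others k CR)
      cut-C = mset (trans (concatF-split k CR) (++⁺ʳ (others k CR) CRₖ))
                   (ih-size Rs copart C C< (λ i → C-premise i (which i)))

      B-premise : ∀ i → i ≡ k ⊎ (i ≢ k × Positive i) → CutPremise (preimage f (Rs i)) B
      B-premise .k (inj₁ ≡.refl) = cutHead-premise _ cut-C
      B-premise i (inj₂ (_ , Pᵢ)) = cutHead-premise _ (Positive.left Pᵢ)

      BR : Fin n → Sequent Ω
      BR i = remainder (B-premise i (which i))

      cut-B : MRLJ J (concatF BR)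
      cut-B = ih-size (preimage f ∘ Rs) (preimage-CoPartition f copart) B B< (λ i → B-premise i (which i))

      tallied : ∀ i → i ≡ k ⊎ (i ≢ k × Positive i) → Σ[ Y ∈ Sequent Ω ] WithCopies i (X i) Y
      tallied .k (inj₁ ≡.refl) = Mixed.rest Nₖ , Mixed.tally Nₖ
      tallied i (inj₂ (_ , Pᵢ)) = Positive.Y₁ Pᵢ ++ Positive.Y₂ Pᵢ , Positive.tally Pᵢ

      Ys : Fin n → Sequent Ω
      Ys i = proj₁ (tallied i (which i))

      BRₖ : BR k ↭ Mixed.rest Nₖ ++ others k CR
      BRₖ with which k
      ... | inj₁ ≡.refl = ↭-reflexive (kept-keepAll _)
      ... | inj₂ (k≢k , _) = ⊥-elim (k≢k ≡.refl)

      Ysₖ : Ys k ↭ Mixed.rest Nₖ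
      Ysₖ with which k
      ... | inj₁ ≡.refl = ↭-refl
      ... | inj₂ (k≢k , _) = ⊥-elim (k≢k ≡.refl)

      CR++BR : ∀ j → k ≢ j → CR j ++ BR j ↭ Ys j
      CR++BR j k≢j with which j
      ... | inj₁ j≡k = ⊥-elim (k≢j (≡.sym j≡k))
      ... | inj₂ (_ , Pⱼ) =
        trans (++⁺ (↭-reflexive (kept-keepAll (Positive.Y₂ Pⱼ))) (↭-reflexive (kept-keepAll (Positive.Y₁ Pⱼ))))
              (++-comm (Positive.Y₂ Pⱼ) (Positive.Y₁ Pⱼ))

      BR↭Ys : concatF BR ↭ concatF Ys
      BR↭Ys = trans (concatF-split k BR)
              (trans (++⁺ʳ (others k BR) BRₖ)
              (trans (↭-reflexive (List.++-assoc (Mixed.rest Nₖ) (others k CR) (others k BR)))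
              (trans (++⁺ˡ (Mixed.rest Nₖ) (trans (↭-sym (others-++ k CR BR)) (others-cong k CR++BR)))
              (trans (++⁺ʳ (others k Ys) (↭-sym Ysₖ)) (↭-sym (concatF-split k Ys))))))

      one-negative : Goal
      one-negative = contract-duplicates (mset BR↭Ys cut-B) (duplicates Ys (λ i → proj₂ (tallied i (which i))))

    principal-imp : (∀ i → PrincipalAt i) → Goal
    principal-imp principal with at-most-one-negative copart U (λ _ → proj₁) (λ i → view i (principal i))
    ... | inj₁ P = all-positive P
    ... | inj₂ (k , N , P) = OneNegative.one-negative k N P

  principal-multicut : ∀ {n} (Rs : Fin n → RoleSet Ω) (copart : CoPartition Rs) (A : Formula Ω)
                       (ps : (i : Fin n) → CutPremise (Rs i) A) →
                       (ih : MulticutContext.HeightIH Rs copart A ps) → MulticutBelow (size A) →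
                       (∀ i → LastRule.PrincipalAt Rs copart A ps ih i) → MulticutContext.Goal Rs copart A ps
  principal-multicut Rs copart (atom a) ps ih ih-size = AtomCase.principal-atom Rs copart a ps
  principal-multicut Rs copart (neg f B) ps ih ih-size = NegCase.principal-neg Rs copart f B ps ih ih-size
  principal-multicut Rs copart (and U B C) ps ih ih-size = AndCase.principal-and Rs copart U B C ps ih ih-size
  principal-multicut Rs copart (imp f U B C) ps ih ih-size = ImpCase.principal-imp Rs copart f U B C ps ih ih-size
  principal-multicut Rs copart (all U B) ps ih ih-size = AllCase.principal-all Rs copart U B ps ih ih-size

  -- Lexicographic induction on the size of the cut formula and the total height of the premises,
  -- each bounded by an explicit counter.
  mutual
    multicut : ∀ (m h : ℕ) {n} (Rs : Fin n → RoleSet Ω) (copart : CoPartition Rs) (A : Formula Ω) →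
               size A ≤ m → (ps : (i : Fin n) → CutPremise (Rs i) A) → sum (heightP ∘ ps) ≤ h →
               MRLJ J (concatF (remainder ∘ ps))
    multicut m h {zero} Rs (_ , covers) A _ ps _ =
      Id (λ ()) (pred 0 []) ((λ ()) , λ r → ⊥-elim (no-part (covers r))) []
      where no-part : ∀ {r} → ∃[ i ] ∁ (Rs i) r ≡ true → ⊥
            no-part (() , _)
    multicut m zero {suc n} Rs copart A size≤ ps sum≤
      with ≤-trans (1≤height J (derivation (ps zero))) (≤-trans (≤-sum zero (heightP ∘ ps)) sum≤)
    ... | ()
    multicut m (suc h) {suc n} Rs copart A size≤ ps sum≤ =
      [ id , principal-multicut Rs copart A ps ih (multicut-below m A size≤) ]′
        (LastRule.permute-or-principal Rs copart A ps ih)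
      where
        ih : MulticutContext.HeightIH Rs copart A ps
        ih A′ size≡ ps′ sum< =
          multicut m h Rs copart A′ (≡.subst (_≤ m) (≡.sym size≡) size≤) ps′ (≤-pred (≤-trans sum< sum≤))

    multicut-below : ∀ m (A : Formula Ω) → size A ≤ m → MulticutBelow (size A)
    multicut-below zero A size≤ Rs′ copart′ A′ size< with ≤-trans size< size≤
    ... | ()
    multicut-below (suc m) A size≤ Rs′ copart′ A′ size< ps′ =
      multicut m (sum (heightP ∘ ps′)) Rs′ copart′ A′ (≤-pred (≤-trans size< size≤)) ps′ ≤-refl

lemma7 : ∀ {Ω : Set} (J : Ultrafilter Ω) (n : ℕ) → 1 ≤ n →
         (Rs : Fin n → RoleSet Ω) → Partition (λ i → ∁ (Rs i)) →
         (A : Formula Ω) (Γs : Fin n → Sequent Ω) →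
         (∀ i → Intu J ((Rs i , A) ∷ Γs i)) →
         (∀ i → MRLJ J ((Rs i , A) ∷ Γs i)) →
         MRLJ J (concat (tabulate Γs))
lemma7 J n _ Rs copart A Γs _ ds =
  mset (concatF-cong (λ i → ↭-reflexive (kept-keepAll (Γs i))))
       (multicut J (size A) (sum (heightP J ∘ ps)) Rs copart A ≤-refl ps ≤-refl)
  where ps : ∀ i → CutPremise J (Rs i) A
        ps i = cutHead-premise J (Γs i) (ds i)
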